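{- Let $m>1$, $n>1$, $v=mn$, $f\ge 3$, and let $A_{i,j}$ ($i,j\in\{1,\ldots,f\}$, $i\neq j$) be a linked system of symmetric group divisible designs of type II with parameters $(v,k,m,n,\lambda_1,\lambda_2)$ and $\sigma,\tau,\rho$, where $\lambda_1<k<(m-1)n$ and $A_{j,i}=A_{i,j}^\top$ for all distinct $i,j$. Then $f\leq m$.
   Context: $I_t$, $J_t$ denote the $t\times t$ identity and all-ones matrices. For integers $m,n\ge 2$ with $v=mn$, $K_{m,n}=I_m\otimes J_n$. A $v\times v$ $(0,1)$-matrix $A$ is a symmetric group divisible design with parameters $(v,k,m,n,\lambda_1,\lambda_2)$ (non-negative integers) if $AA^\top=A^\top A=kI_v+\lambda_1(K_{m,n}-I_v)+\lambda_2(J_v-K_{m,n})$. For $f\ge3$, a family $A_{i,j}$ ($i\neq j\in\{1,\ldots,f\}$) of such designs with common parameters is a linked system of symmetric group divisible designs of type II with parameters $(v,k,m,n,\lambda_1,\lambda_2)$ and $\sigma,\tau,\rho$ if each $A_{i,j}+K_{m,n}$ is a $(0,1)$-matrix and $\sigma,\tau,\rho$ are non-negative integers with $A_{i,j}A_{j,l}=\sigma A_{i,l}+\tau(J_v-A_{i,l}-K_{m,n})+\rho K_{m,n}$ for all mutually distinct $i,j,l$. -}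

module Defs where

open import Data.Nat using (ℕ; zero; suc; _*_; _<_; _≤_; NonZero)
open import Data.Nat.DivMod using (_/_)
open import Data.Fin using (Fin; toℕ)
import Data.Fin as F
open import Data.Integer using (ℤ; +_; _+_; _-_) renaming (_*_ to _*ℤ_)
open import Data.Product using (_×_)
open import Data.Sum using (_⊎_)
open import Relation.Nullary using (yes; no)
import Data.Nat
open import Relation.Binary.PropositionalEquality using (_≡_; _≢_)

Mat : ℕ → Set
Mat v = Fin v → Fin v → ℤ

Σ : (t : ℕ) → (Fin t → ℤ) → ℤ
Σ zero    g = + 0
Σ (suc t) g = g F.zero + Σ t (λ i → g (F.suc i))

_⊗_ : {v : ℕ} → Mat v → Mat v → Mat v
(A ⊗ B) x y = Σ _ (λ z → A x z *ℤ B z y)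

transpose : {v : ℕ} → Mat v → Mat v
transpose A x y = A y x

δ : {v : ℕ} → Fin v → Fin v → ℤ
δ x y with x F.≟ y
... | yes _ = + 1
... | no  _ = + 0

I : (v : ℕ) → Mat v
I v = δ

J : (v : ℕ) → Mat v
J v _ _ = + 1

-- K_{m,n} = I_m ⊗ J_n on points Fin (m * n); point x lies in group ⌊x/n⌋
K : (m n : ℕ) .{{_ : NonZero n}} → Mat (m * n)
K m n x y with (toℕ x / n) Data.Nat.≟ (toℕ y / n)
... | yes _ = + 1
... | no  _ = + 0

IsZeroOne : {v : ℕ} → Mat v → Set
IsZeroOne A = ∀ x y → (A x y ≡ + 0) ⊎ (A x y ≡ + 1)

IsSGDD : (m n k λ₁ λ₂ : ℕ) .{{_ : NonZero n}} → Mat (m * n) → Set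
IsSGDD m n k λ₁ λ₂ A =
  IsZeroOne A ×
  (∀ x y → (A ⊗ transpose A) x y ≡ RHS x y) ×
  (∀ x y → (transpose A ⊗ A) x y ≡ RHS x y)
  where
  v = m * n
  RHS : Mat (m * n)
  RHS x y = (+ k) *ℤ I v x y + (+ λ₁) *ℤ (K m n x y - I v x y)
            + (+ λ₂) *ℤ (J v x y - K m n x y)

IsLinkedTypeII : (f m n k λ₁ λ₂ σ τ ρ : ℕ) .{{_ : NonZero n}} →
                 (Fin f → Fin f → Mat (m * n)) → Set
IsLinkedTypeII f m n k λ₁ λ₂ σ τ ρ A =
  (3 ≤ f) ×
  (∀ i j → i ≢ j → IsSGDD m n k λ₁ λ₂ (A i j)) ×
  (∀ i j → i ≢ j → IsZeroOne (λ x y → A i j x y + K m n x y)) ×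
  (∀ i j l → i ≢ j → j ≢ l → i ≢ l → ∀ x y →
     (A i j ⊗ A j l) x y ≡
       (+ σ) *ℤ A i l x y
       + (+ τ) *ℤ (J (m * n) x y - A i l x y - K m n x y)
       + (+ ρ) *ℤ K m n x y)

module Submission where

-- The rows of the A_{i,0} (i ≠ 0) at the n points of group 0 form an (f-1)n × mn matrix X
-- vanishing on the columns of group 0, so rank X ≤ (m-1)n.  The design equations give
-- X Xᵀ = α I + β K + ρ J (α = k - λ₁, β = λ₁ - ρ) in the algebra spanned by I, K, J.
-- Ranks are bounded by a trace inequality: a symmetric M with M² = dM (d ≠ 0), zero
-- diagonal on group 0 and tr M = d·T, T > 0, has T ≤ (m-1)n (Cauchy–Schwarz).  It is
-- applied to M = Xᵀ W X, W in the I,K,J-algebra.  If E = α + nβ ≠ 0 we get T = (f-1)n - 1.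
-- If E = 0 we first show that the rows of every A_{i,0}K are constant on groups (ruling
-- out σ = τ separately), add α times the projection onto the group-constant vectors off
-- group 0, and get T = (f-1)(n-1) + (m-1).  Either bound gives f ≤ m.

open import Data.Nat as ℕ using (ℕ; zero; suc; NonZero; z≤n; s≤s; _∸_)
import Data.Nat.Properties as ℕP
open import Data.Nat.DivMod using (_/_; _%_; m<n⇒m/n≡0; m/n≡1+[m∸n]/n; m<n*o⇒m/o<n; m%n<n; m≡m%n+[m/n]*n)
open import Data.Fin as F using (Fin; toℕ; _↑ˡ_; _↑ʳ_)
import Data.Fin.Properties as FP
open import Data.Integer as ℤ using (ℤ; +_; -_; _+_; _-_; _*_; _≤_; _<_; +≤+; +<+)
import Data.Integer.Properties as ℤP
open import Data.Integer.Tactic.RingSolver using (solve-∀)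
open import Data.Product using (_,_; proj₁; proj₂)
open import Data.Sum using (_⊎_; inj₁; inj₂)
open import Data.Empty using (⊥; ⊥-elim)
open import Relation.Nullary using (yes; no; Dec; ¬_)
open import Relation.Binary.PropositionalEquality hiding (J)

open import Defs

decide : ∀ {a c} {A : Set a} {C : Set c} → Dec A → (A → C) → (¬ A → C) → C
decide (yes a) onYes onNo = onYes a
decide (no ¬a) onYes onNo = onNo ¬a

Σ-cong : ∀ t {g h : Fin t → ℤ} → (∀ i → g i ≡ h i) → Σ t g ≡ Σ t h
Σ-cong zero    e = refl
Σ-cong (suc t) e = cong₂ _+_ (e F.zero) (Σ-cong t (λ i → e (F.suc i)))

Σ-zero : ∀ t {g : Fin t → ℤ} → (∀ i → g i ≡ + 0) → Σ t g ≡ + 0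
Σ-zero zero    e = refl
Σ-zero (suc t) e = cong₂ _+_ (e F.zero) (Σ-zero t (λ i → e (F.suc i)))

Σ-+ : ∀ t (g h : Fin t → ℤ) → Σ t (λ i → g i + h i) ≡ Σ t g + Σ t h
Σ-+ zero    g h = refl
Σ-+ (suc t) g h =
  trans (cong (_+_ (g F.zero + h F.zero)) (Σ-+ t (λ i → g (F.suc i)) (λ i → h (F.suc i))))
        (interchange (g F.zero) (h F.zero) _ _)
  where
  interchange : ∀ a b c d → (a + b) + (c + d) ≡ (a + c) + (b + d)
  interchange = solve-∀

Σ-*ˡ : ∀ t c (g : Fin t → ℤ) → Σ t (λ i → c * g i) ≡ c * Σ t g
Σ-*ˡ zero    c g = sym (ℤP.*-zeroʳ c)
Σ-*ˡ (suc t) c g = trans (cong (_+_ (c * g F.zero)) (Σ-*ˡ t c _)) (sym (ℤP.*-distribˡ-+ c _ _))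

Σ-*ʳ : ∀ t c (g : Fin t → ℤ) → Σ t (λ i → g i * c) ≡ Σ t g * c
Σ-*ʳ t c g = trans (Σ-cong t (λ i → ℤP.*-comm (g i) c)) (trans (Σ-*ˡ t c g) (ℤP.*-comm c _))

Σ-neg : ∀ t (g : Fin t → ℤ) → Σ t (λ i → - g i) ≡ - Σ t g
Σ-neg zero    g = refl
Σ-neg (suc t) g = trans (cong (_+_ (- g F.zero)) (Σ-neg t _)) (sym (ℤP.neg-distrib-+ (g F.zero) _))

Σ-- : ∀ t (g h : Fin t → ℤ) → Σ t (λ i → g i - h i) ≡ Σ t g - Σ t h
Σ-- t g h = trans (Σ-+ t g (λ i → - h i)) (cong (_+_ (Σ t g)) (Σ-neg t h))

Σ-diff-product : ∀ t (g₁ g₂ h₁ h₂ : Fin t → ℤ) →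
  Σ t (λ y → (g₁ y - g₂ y) * (h₁ y - h₂ y)) ≡
  Σ t (λ y → g₁ y * h₁ y) - Σ t (λ y → g₁ y * h₂ y) - Σ t (λ y → g₂ y * h₁ y) + Σ t (λ y → g₂ y * h₂ y)
Σ-diff-product t g₁ g₂ h₁ h₂ = begin
  Σ t (λ y → (g₁ y - g₂ y) * (h₁ y - h₂ y))
    ≡⟨ Σ-cong t (λ y → expand (g₁ y) (g₂ y) (h₁ y) (h₂ y)) ⟩
  Σ t (λ y → g₁ y * h₁ y - g₁ y * h₂ y - g₂ y * h₁ y + g₂ y * h₂ y)
    ≡⟨ Σ-+ t _ _ ⟩
  Σ t (λ y → g₁ y * h₁ y - g₁ y * h₂ y - g₂ y * h₁ y) + Σ t (λ y → g₂ y * h₂ y)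
    ≡⟨ cong (_+ Σ t (λ y → g₂ y * h₂ y)) (trans (Σ-- t _ _) (cong (_- Σ t (λ y → g₂ y * h₁ y)) (Σ-- t _ _))) ⟩
  Σ t (λ y → g₁ y * h₁ y) - Σ t (λ y → g₁ y * h₂ y) - Σ t (λ y → g₂ y * h₁ y) + Σ t (λ y → g₂ y * h₂ y) ∎
  where
  open ≡-Reasoning
  expand : ∀ a b c d → (a - b) * (c - d) ≡ a * c - a * d - b * c + b * d
  expand = solve-∀

Σ-const : ∀ t c → Σ t (λ _ → c) ≡ + t * c
Σ-const zero    c = sym (ℤP.*-zeroˡ c)
Σ-const (suc t) c = trans (cong (_+_ c) (Σ-const t c)) (step (+ t) c)
  where
  step : ∀ t c → c + t * c ≡ (+ 1 + t) * c
  step = solve-∀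

Σ-swap : ∀ s t (g : Fin s → Fin t → ℤ) →
         Σ s (λ i → Σ t (λ j → g i j)) ≡ Σ t (λ j → Σ s (λ i → g i j))
Σ-swap zero    t g = sym (Σ-zero t (λ _ → refl))
Σ-swap (suc s) t g =
  trans (cong (_+_ (Σ t (g F.zero))) (Σ-swap s t (λ i → g (F.suc i))))
        (sym (Σ-+ t (g F.zero) (λ j → Σ s (λ i → g (F.suc i) j))))

Σ-split : ∀ a b (g : Fin (a ℕ.+ b) → ℤ) →
          Σ (a ℕ.+ b) g ≡ Σ a (λ i → g (i ↑ˡ b)) + Σ b (λ i → g (a ↑ʳ i))
Σ-split zero    b g = sym (ℤP.+-identityˡ _)
Σ-split (suc a) b g =
  trans (cong (_+_ (g F.zero)) (Σ-split a b (λ i → g (F.suc i))))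
        (sym (ℤP.+-assoc (g F.zero) _ _))

δ-refl : ∀ {v} (x : Fin v) → δ x x ≡ + 1
δ-refl x with x F.≟ x
... | yes _ = refl
... | no x≢x = ⊥-elim (x≢x refl)

δ-ne : ∀ {v} {x y : Fin v} → x ≢ y → δ x y ≡ + 0
δ-ne {x = x} {y} x≢y with x F.≟ y
... | yes x≡y = ⊥-elim (x≢y x≡y)
... | no _ = refl

δ-sym : ∀ {v} (x y : Fin v) → δ x y ≡ δ y x
δ-sym x y = decide (x F.≟ y)
  (λ x≡y → trans (cong (δ x) (sym x≡y)) (cong (λ z → δ z x) x≡y))
  (λ x≢y → trans (δ-ne x≢y) (sym (δ-ne (λ y≡x → x≢y (sym y≡x)))))

δ-suc : ∀ {t} (x y : Fin t) → δ (F.suc x) (F.suc y) ≡ δ x y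
δ-suc x y = decide (x F.≟ y)
  (λ x≡y → trans (cong (δ (F.suc x)) (cong F.suc (sym x≡y)))
                 (trans (δ-refl (F.suc x)) (trans (sym (δ-refl x)) (cong (δ x) x≡y))))
  (λ x≢y → trans (δ-ne (λ e → x≢y (FP.suc-injective e))) (sym (δ-ne x≢y)))

Σ-δ : ∀ t (x : Fin t) (h : Fin t → ℤ) → Σ t (λ y → δ x y * h y) ≡ h x
Σ-δ (suc t) F.zero h =
  trans (cong₂ _+_ (cong (_* h F.zero) (δ-refl {suc t} F.zero))
                   (Σ-zero t (λ i → cong (_* h (F.suc i)) (δ-ne {x = F.zero} {F.suc i} λ ()))))
        (trans (ℤP.+-identityʳ _) (ℤP.*-identityˡ _))
Σ-δ (suc t) (F.suc x) h =
  trans (cong₂ _+_ (cong (_* h F.zero) (δ-ne {x = F.suc x} {F.zero} λ ()))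
                   (trans (Σ-cong t (λ i → cong (_* h (F.suc i)) (δ-suc x i)))
                          (Σ-δ t x (λ i → h (F.suc i)))))
        (ℤP.+-identityˡ _)

+-cancelʳ : ∀ c a b → a + c ≡ b + c → a ≡ b
+-cancelʳ c a b e = trans (undo a c) (trans (cong (_- c) e) (sym (undo b c)))
  where
  undo : ∀ a c → a ≡ a + c - c
  undo = solve-∀

*-≢0 : ∀ {a b} → a ≢ + 0 → b ≢ + 0 → a * b ≢ + 0
*-≢0 {a} a≢0 b≢0 ab≡0 with ℤP.i*j≡0⇒i≡0∨j≡0 a ab≡0
... | inj₁ a≡0 = a≢0 a≡0
... | inj₂ b≡0 = b≢0 b≡0

0<n-1 : ∀ {n} → 1 ℕ.< n → + 0 < + n - + 1
0<n-1 {n} 1<n = subst (_< + n - + 1) (ℤP.+-inverseʳ (+ 1)) (ℤP.+-monoˡ-< (- + 1) (+<+ 1<n))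

0≤square : ∀ x → + 0 ≤ x * x
0≤square (+ n)       = subst (+ 0 ≤_) (sym (ℤP.+◃n≡+n (n ℕ.* n))) (+≤+ z≤n)
0≤square ℤ.-[1+ n ] = +≤+ z≤n

square≡0 : ∀ x → x * x ≡ + 0 → x ≡ + 0
square≡0 x e with ℤP.i*j≡0⇒i≡0∨j≡0 x e
... | inj₁ x≡0 = x≡0
... | inj₂ x≡0 = x≡0

Σ-nonneg : ∀ t (g : Fin t → ℤ) → (∀ i → + 0 ≤ g i) → + 0 ≤ Σ t g
Σ-nonneg zero    g g≥0 = ℤP.≤-refl
Σ-nonneg (suc t) g g≥0 = ℤP.+-mono-≤ (g≥0 F.zero) (Σ-nonneg t _ (λ i → g≥0 (F.suc i)))

Σ-term : ∀ t (g : Fin t → ℤ) → (∀ i → + 0 ≤ g i) → ∀ x → g x ≤ Σ t g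
Σ-term (suc t) g g≥0 F.zero =
  subst (_≤ Σ (suc t) g) (ℤP.+-identityʳ (g F.zero))
        (ℤP.+-monoʳ-≤ (g F.zero) (Σ-nonneg t _ (λ i → g≥0 (F.suc i))))
Σ-term (suc t) g g≥0 (F.suc x) =
  subst (_≤ Σ (suc t) g) (ℤP.+-identityˡ (g (F.suc x)))
        (ℤP.+-mono-≤ (g≥0 F.zero) (Σ-term t _ (λ i → g≥0 (F.suc i)) x))

Σ-mono : ∀ t (g h : Fin t → ℤ) → (∀ i → g i ≤ h i) → Σ t g ≤ Σ t h
Σ-mono zero    g h g≤h = ℤP.≤-refl
Σ-mono (suc t) g h g≤h = ℤP.+-mono-≤ (g≤h F.zero) (Σ-mono t _ _ (λ i → g≤h (F.suc i)))

Σ-squares≡0 : ∀ t (g : Fin t → ℤ) → Σ t (λ i → g i * g i) ≡ + 0 → ∀ i → g i ≡ + 0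
Σ-squares≡0 t g e i =
  square≡0 (g i) (ℤP.≤-antisym (subst (g i * g i ≤_) e (Σ-term t _ (λ j → 0≤square (g j)) i))
                               (0≤square (g i)))

Σ-square-diff : ∀ t c (y : Fin t → ℤ) →
  Σ t (λ i → (c - y i) * (c - y i)) ≡ + t * (c * c) + (- (+ 2 * c)) * Σ t y + Σ t (λ i → y i * y i)
Σ-square-diff t c y = begin
  Σ t (λ i → (c - y i) * (c - y i))
    ≡⟨ Σ-cong t (λ i → expand c (y i)) ⟩
  Σ t (λ i → c * c + ((- (+ 2 * c)) * y i + y i * y i))
    ≡⟨ Σ-+ t _ _ ⟩
  Σ t (λ _ → c * c) + Σ t (λ i → (- (+ 2 * c)) * y i + y i * y i)
    ≡⟨ cong₂ _+_ (Σ-const t (c * c)) (Σ-+ t _ _) ⟩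
  + t * (c * c) + (Σ t (λ i → (- (+ 2 * c)) * y i) + Σ t (λ i → y i * y i))
    ≡⟨ cong (λ s → + t * (c * c) + (s + Σ t (λ i → y i * y i))) (Σ-*ˡ t (- (+ 2 * c)) y) ⟩
  + t * (c * c) + ((- (+ 2 * c)) * Σ t y + Σ t (λ i → y i * y i))
    ≡⟨ sym (ℤP.+-assoc (+ t * (c * c)) _ _) ⟩
  + t * (c * c) + (- (+ 2 * c)) * Σ t y + Σ t (λ i → y i * y i) ∎
  where
  open ≡-Reasoning
  expand : ∀ c y → (c - y) * (c - y) ≡ c * c + ((- (+ 2 * c)) * y + y * y)
  expand = solve-∀

cauchy-schwarz : ∀ t (y : Fin t → ℤ) → Σ t y * Σ t y ≤ + t * Σ t (λ i → y i * y i)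
cauchy-schwarz zero    y = ℤP.≤-refl
cauchy-schwarz (suc t) y =
  ℤP.0≤i-j⇒j≤i (subst (+ 0 ≤_) (sym (regroup (+ t) c S Q))
    (ℤP.+-mono-≤ (ℤP.i≤j⇒0≤j-i (cauchy-schwarz t y′)) squares≥0))
  where
  y′ : Fin t → ℤ
  y′ i = y (F.suc i)
  c S Q : ℤ
  c = y F.zero
  S = Σ t y′
  Q = Σ t (λ i → y′ i * y′ i)
  squares≥0 : + 0 ≤ + t * (c * c) + (- (+ 2 * c)) * S + Q
  squares≥0 = subst (+ 0 ≤_) (Σ-square-diff t c y′) (Σ-nonneg t _ (λ i → 0≤square (c - y′ i)))
  regroup : ∀ t c S Q → (+ 1 + t) * (c * c + Q) - (c + S) * (c + S)
                      ≡ (t * Q - S * S) + (t * (c * c) + (- (+ 2 * c)) * S + Q)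
  regroup = solve-∀

-- Rectangular integer matrices, their product, transpose and trace.  On square
-- matrices _·_ and _ᵀ agree definitionally with Defs' _⊗_ and transpose.

Matrix : ℕ → ℕ → Set
Matrix a b = Fin a → Fin b → ℤ

infixl 7 _·_
_·_ : ∀ {a b c} → Matrix a b → Matrix b c → Matrix a c
(A · B) x y = Σ _ (λ z → A x z * B z y)

_ᵀ : ∀ {a b} → Matrix a b → Matrix b a
(A ᵀ) x y = A y x

tr : ∀ {a} → Matrix a a → ℤ
tr {a} A = Σ a (λ x → A x x)

comb : ∀ {a b} → ℤ → Matrix a b → ℤ → Matrix a b → ℤ → Matrix a b → Matrix a b
comb p A q B r C x y = p * A x y + q * B x y + r * C x y

·-assoc : ∀ {a b c d} (A : Matrix a b) (B : Matrix b c) (C : Matrix c d) x y →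
          (A · B · C) x y ≡ (A · (B · C)) x y
·-assoc {b = b} {c} A B C x y = begin
  Σ c (λ w → Σ b (λ z → A x z * B z w) * C w y)   ≡⟨ Σ-cong c (λ w → sym (Σ-*ʳ b (C w y) _)) ⟩
  Σ c (λ w → Σ b (λ z → A x z * B z w * C w y))   ≡⟨ Σ-swap c b _ ⟩
  Σ b (λ z → Σ c (λ w → A x z * B z w * C w y))
    ≡⟨ Σ-cong b (λ z → trans (Σ-cong c (λ w → ℤP.*-assoc (A x z) _ _)) (Σ-*ˡ c (A x z) _)) ⟩
  Σ b (λ z → A x z * Σ c (λ w → B z w * C w y))   ∎
  where open ≡-Reasoning

·-congˡ : ∀ {a b c} {A A′ : Matrix a b} (B : Matrix b c) →
          (∀ x y → A x y ≡ A′ x y) → ∀ x y → (A · B) x y ≡ (A′ · B) x y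
·-congˡ {b = b} B e x y = Σ-cong b (λ z → cong (_* B z y) (e x z))

·-congʳ : ∀ {a b c} (A : Matrix a b) {B B′ : Matrix b c} →
          (∀ x y → B x y ≡ B′ x y) → ∀ x y → (A · B) x y ≡ (A · B′) x y
·-congʳ {b = b} A e x y = Σ-cong b (λ z → cong (A x z *_) (e z y))

·-transpose : ∀ {a b c} (A : Matrix a b) (B : Matrix b c) x y → (A · B) y x ≡ (B ᵀ · A ᵀ) x y
·-transpose {b = b} A B x y = Σ-cong b (λ z → ℤP.*-comm (A y z) (B z x))

tr-cyclic : ∀ {a b} (A : Matrix a b) (B : Matrix b a) → tr (A · B) ≡ tr (B · A)
tr-cyclic {a} {b} A B = trans (Σ-swap a b _) (Σ-cong b (λ z → Σ-cong a (λ x → ℤP.*-comm (A x z) (B z x))))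

·-combˡ : ∀ {a b c} p (A : Matrix a b) q B r C (D : Matrix b c) x y →
          (comb p A q B r C · D) x y ≡ p * (A · D) x y + q * (B · D) x y + r * (C · D) x y
·-combˡ {b = b} p A q B r C D x y = begin
  Σ b (λ z → (p * A x z + q * B x z + r * C x z) * D z y)
    ≡⟨ Σ-cong b (λ z → distrib p (A x z) q (B x z) r (C x z) (D z y)) ⟩
  Σ b (λ z → p * (A x z * D z y) + q * (B x z * D z y) + r * (C x z * D z y))
    ≡⟨ trans (Σ-+ b _ _) (cong (_+ _) (Σ-+ b _ _)) ⟩
  Σ b (λ z → p * (A x z * D z y)) + Σ b (λ z → q * (B x z * D z y)) + Σ b (λ z → r * (C x z * D z y))
    ≡⟨ cong₂ _+_ (cong₂ _+_ (Σ-*ˡ b p _) (Σ-*ˡ b q _)) (Σ-*ˡ b r _) ⟩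
  p * (A · D) x y + q * (B · D) x y + r * (C · D) x y ∎
  where
  open ≡-Reasoning
  distrib : ∀ p a q b r c d → (p * a + q * b + r * c) * d ≡ p * (a * d) + q * (b * d) + r * (c * d)
  distrib = solve-∀

·-combʳ : ∀ {a b c} (D : Matrix a b) p (A : Matrix b c) q B r C x y →
          (D · comb p A q B r C) x y ≡ p * (D · A) x y + q * (D · B) x y + r * (D · C) x y
·-combʳ {b = b} D p A q B r C x y = begin
  Σ b (λ z → D x z * (p * A z y + q * B z y + r * C z y))
    ≡⟨ Σ-cong b (λ z → distrib p (A z y) q (B z y) r (C z y) (D x z)) ⟩
  Σ b (λ z → p * (D x z * A z y) + q * (D x z * B z y) + r * (D x z * C z y))
    ≡⟨ trans (Σ-+ b _ _) (cong (_+ _) (Σ-+ b _ _)) ⟩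
  Σ b (λ z → p * (D x z * A z y)) + Σ b (λ z → q * (D x z * B z y)) + Σ b (λ z → r * (D x z * C z y))
    ≡⟨ cong₂ _+_ (cong₂ _+_ (Σ-*ˡ b p _) (Σ-*ˡ b q _)) (Σ-*ˡ b r _) ⟩
  p * (D · A) x y + q * (D · B) x y + r * (D · C) x y ∎
  where
  open ≡-Reasoning
  distrib : ∀ p a q b r c d → d * (p * a + q * b + r * c) ≡ p * (d * a) + q * (d * b) + r * (d * c)
  distrib = solve-∀

·-scaleˡ : ∀ {a b c} p (A : Matrix a b) (C : Matrix b c) x y →
           ((λ u w → p * A u w) · C) x y ≡ p * (A · C) x y
·-scaleˡ {b = b} p A C x y = trans (Σ-cong b (λ z → ℤP.*-assoc p _ _)) (Σ-*ˡ b p _)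

·-scaleʳ : ∀ {a b c} (A : Matrix a b) p (C : Matrix b c) x y →
           (A · (λ u w → p * C u w)) x y ≡ p * (A · C) x y
·-scaleʳ {b = b} A p C x y = trans (Σ-cong b (λ z → swap (A x z) p (C z y))) (Σ-*ˡ b p _)
  where
  swap : ∀ a p c → a * (p * c) ≡ p * (a * c)
  swap = solve-∀

·-δˡ : ∀ {a c} (C : Matrix a c) x y → (δ · C) x y ≡ C x y
·-δˡ {a} C x y = Σ-δ a x (λ z → C z y)

·-δʳ : ∀ {a c} (C : Matrix c a) x y → (C · δ) x y ≡ C x y
·-δʳ {a} C x y =
  trans (Σ-cong a (λ z → trans (ℤP.*-comm (C x z) _) (cong (_* C x z) (δ-sym z y)))) (Σ-δ a y (C x))

infixl 6 _⊕_
_⊕_ : ∀ {a b} → Matrix a b → Matrix a b → Matrix a b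
(A ⊕ B) x y = A x y + B x y

orthogonal-sum : ∀ {a} (P Q : Matrix a a) d →
  (∀ x y → (P · P) x y ≡ d * P x y) → (∀ x y → (Q · Q) x y ≡ d * Q x y) →
  (∀ x y → (P · Q) x y ≡ + 0) → (∀ x y → (Q · P) x y ≡ + 0) →
  ∀ x y → ((P ⊕ Q) · (P ⊕ Q)) x y ≡ d * (P ⊕ Q) x y
orthogonal-sum {a} P Q d P² Q² PQ QP x y = begin
  ((P ⊕ Q) · (P ⊕ Q)) x y
    ≡⟨ Σ-cong a (λ z → expand (P x z) (Q x z) (P z y) (Q z y)) ⟩
  Σ a (λ z → P x z * P z y + P x z * Q z y + Q x z * P z y + Q x z * Q z y)
    ≡⟨ trans (Σ-+ a _ _) (cong (_+ (Q · Q) x y) (trans (Σ-+ a _ _) (cong (_+ (Q · P) x y) (Σ-+ a _ _)))) ⟩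
  (P · P) x y + (P · Q) x y + (Q · P) x y + (Q · Q) x y
    ≡⟨ cong₂ _+_ (cong₂ _+_ (cong₂ _+_ (P² x y) (PQ x y)) (QP x y)) (Q² x y) ⟩
  d * P x y + + 0 + + 0 + d * Q x y
    ≡⟨ collect d (P x y) (Q x y) ⟩
  d * (P ⊕ Q) x y ∎
  where
  open ≡-Reasoning
  expand : ∀ p q p′ q′ → (p + q) * (p′ + q′) ≡ p * p′ + p * q′ + q * p′ + q * q′
  expand = solve-∀
  collect : ∀ d p q → d * p + + 0 + + 0 + d * q ≡ d * (p + q)
  collect = solve-∀

-- A symmetric M on n + r coordinates with M² = d·M has rank tr M / d;
-- if its diagonal vanishes on the first n coordinates, Cauchy–Schwarz on the remaining r
-- diagonal entries together with Σ_p M_pp² ≤ Σ_{p,q} M_pq² = tr (M²) = d·tr M gives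
-- (tr M)² ≤ r·d·tr M, hence rank M ≤ r.

trace-square-bound : ∀ n r (M : Matrix (n ℕ.+ r) (n ℕ.+ r)) d →
  (∀ p q → M p q ≡ M q p) → (∀ p q → (M · M) p q ≡ d * M p q) →
  (∀ u → M (u ↑ˡ r) (u ↑ˡ r) ≡ + 0) →
  tr M * tr M ≤ + r * (d * tr M)
trace-square-bound n r M d M-sym M²≡dM diag₀ = begin
  tr M * tr M                                  ≡⟨ cong (λ s → s * s) tr≡Σy ⟩
  Σ r y * Σ r y                                ≤⟨ cauchy-schwarz r y ⟩
  + r * Σ r (λ i → y i * y i)                  ≤⟨ ℤP.*-monoˡ-≤-nonNeg (+ r) diagonal≤all ⟩
  + r * Σ v (λ p → Σ v (λ q → M p q * M p q))  ≡⟨ cong (+ r *_) all≡trM² ⟩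
  + r * (d * tr M)                             ∎
  where
  open ℤP.≤-Reasoning
  v : ℕ
  v = n ℕ.+ r
  y : Fin r → ℤ
  y i = M (n ↑ʳ i) (n ↑ʳ i)
  tr≡Σy : tr M ≡ Σ r y
  tr≡Σy = trans (Σ-split n r (λ p → M p p)) (trans (cong (_+ Σ r y) (Σ-zero n diag₀)) (ℤP.+-identityˡ _))
  diagonal≤all : Σ r (λ i → y i * y i) ≤ Σ v (λ p → Σ v (λ q → M p q * M p q))
  diagonal≤all = ℤP.≤-trans tail≤diagonal
    (Σ-mono v _ _ (λ p → Σ-term v (λ q → M p q * M p q) (λ q → 0≤square (M p q)) p))
    where
    tail≤diagonal : Σ r (λ i → y i * y i) ≤ Σ v (λ p → M p p * M p p)
    tail≤diagonal =
      subst (Σ r (λ i → y i * y i) ≤_) (sym (Σ-split n r (λ p → M p p * M p p)))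
        (subst (_≤ Σ n (λ u → M (u ↑ˡ r) (u ↑ˡ r) * M (u ↑ˡ r) (u ↑ˡ r)) + Σ r (λ i → y i * y i))
               (ℤP.+-identityˡ _)
               (ℤP.+-monoˡ-≤ _ (Σ-nonneg n _ (λ u → 0≤square (M (u ↑ˡ r) (u ↑ˡ r))))))
  all≡trM² : Σ v (λ p → Σ v (λ q → M p q * M p q)) ≡ d * tr M
  all≡trM² = trans (Σ-cong v (λ p → trans (Σ-cong v (λ q → cong (M p q *_) (M-sym p q))) (M²≡dM p p)))
                   (Σ-*ˡ v d (λ p → M p p))

rank-bound : ∀ n r (M : Matrix (n ℕ.+ r) (n ℕ.+ r)) d T →
  (∀ p q → M p q ≡ M q p) → (∀ p q → (M · M) p q ≡ d * M p q) →
  (∀ u → M (u ↑ˡ r) (u ↑ˡ r) ≡ + 0) →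
  d ≢ + 0 → tr M ≡ d * T → + 0 < T → T ≤ + r
rank-bound n r M d T M-sym M²≡dM diag₀ d≢0 trM≡dT T>0 =
  ℤP.*-cancelˡ-≤-pos T (+ r) T {{ℤ.positive T>0}}
    (ℤP.*-cancelˡ-≤-pos (T * T) (T * + r) (d * d) {{ℤ.positive d²>0}}
      (subst₂ _≤_ (squares d T) (rearrange d T (+ r))
        (subst (λ s → s * s ≤ + r * (d * s)) trM≡dT (trace-square-bound n r M d M-sym M²≡dM diag₀))))
  where
  d²>0 : + 0 < d * d
  d²>0 = ℤP.≤∧≢⇒< (0≤square d) (λ e → d≢0 (square≡0 d (sym e)))
  squares : ∀ d T → (d * T) * (d * T) ≡ (d * d) * (T * T)
  squares = solve-∀
  rearrange : ∀ d T r → r * (d * (d * T)) ≡ (d * d) * (T * r)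
  rearrange = solve-∀

module _ (n : ℕ) .{{_ : NonZero n}} where

  group : ∀ {v} → Fin v → ℕ
  group x = toℕ x / n

  K-yes : ∀ m (x y : Fin (m ℕ.* n)) → group x ≡ group y → K m n x y ≡ + 1
  K-yes m x y e with toℕ x / n ℕ.≟ toℕ y / n
  ... | yes _ = refl
  ... | no ne = ⊥-elim (ne e)

  K-no : ∀ m (x y : Fin (m ℕ.* n)) → group x ≢ group y → K m n x y ≡ + 0
  K-no m x y ne with toℕ x / n ℕ.≟ toℕ y / n
  ... | yes e = ⊥-elim (ne e)
  ... | no _ = refl

  K-refl : ∀ m (x : Fin (m ℕ.* n)) → K m n x x ≡ + 1
  K-refl m x = K-yes m x x refl

  K-sym : ∀ m (x y : Fin (m ℕ.* n)) → K m n x y ≡ K m n y x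
  K-sym m x y = decide (group x ℕ.≟ group y)
    (λ e → trans (K-yes m x y e) (sym (K-yes m y x (sym e))))
    (λ ne → trans (K-no m x y ne) (sym (K-no m y x (λ e → ne (sym e)))))

  K-group : ∀ m (x z y : Fin (m ℕ.* n)) → group x ≡ group z → K m n z y ≡ K m n x y
  K-group m x z y x~z = decide (group x ℕ.≟ group y)
    (λ x~y → trans (K-yes m z y (trans (sym x~z) x~y)) (sym (K-yes m x y x~y)))
    (λ x≁y → trans (K-no m z y (λ z~y → x≁y (trans x~z z~y))) (sym (K-no m x y x≁y)))

  K≡1⇒group : ∀ m (x y : Fin (m ℕ.* n)) → K m n x y ≡ + 1 → group x ≡ group y
  K≡1⇒group m x y K≡1 = decide (group x ℕ.≟ group y) (λ e → e)
    (λ ne → ⊥-elim (0≢1 (trans (sym (K-no m x y ne)) K≡1)))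
    where
    0≢1 : + 0 ≢ + 1
    0≢1 ()

  group-↑ˡ : ∀ r (u : Fin n) → group (u ↑ˡ r) ≡ 0
  group-↑ˡ r u = trans (cong (_/ n) (FP.toℕ-↑ˡ u r)) (m<n⇒m/n≡0 (FP.toℕ<n u))

  group-↑ʳ : ∀ {r} (y : Fin r) → group (n ↑ʳ y) ≡ suc (group y)
  group-↑ʳ y = trans (cong (_/ n) (FP.toℕ-↑ʳ n y))
    (trans (m/n≡1+[m∸n]/n (ℕP.m≤m+n n (toℕ y))) (cong (λ z → suc (z / n)) (ℕP.m+n∸m≡n n (toℕ y))))

  group< : ∀ m (x : Fin (m ℕ.* n)) → group x ℕ.< m
  group< m x = m<n*o⇒m/o<n {toℕ x} {m} {n} (FP.toℕ<n x)

  inGroup : ∀ {v} → ℕ → Fin v → ℤ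
  inGroup g y with g ℕ.≟ group y
  ... | yes _ = + 1
  ... | no _ = + 0

  inGroup-yes : ∀ {v} g (y : Fin v) → g ≡ group y → inGroup g y ≡ + 1
  inGroup-yes g y e with g ℕ.≟ group y
  ... | yes _ = refl
  ... | no ne = ⊥-elim (ne e)

  inGroup-no : ∀ {v} g (y : Fin v) → g ≢ group y → inGroup g y ≡ + 0
  inGroup-no g y ne with g ℕ.≟ group y
  ... | yes e = ⊥-elim (ne e)
  ... | no _ = refl

  group-size : ∀ m g → g ℕ.< m → Σ (m ℕ.* n) (inGroup g) ≡ + n
  group-size (suc m) zero _ = begin
    Σ (n ℕ.+ m ℕ.* n) (inGroup 0)
      ≡⟨ Σ-split n (m ℕ.* n) (inGroup 0) ⟩
    Σ n (λ u → inGroup 0 (u ↑ˡ m ℕ.* n)) + Σ (m ℕ.* n) (λ y → inGroup 0 (n ↑ʳ y))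
      ≡⟨ cong₂ _+_ (Σ-cong n (λ u → inGroup-yes 0 _ (sym (group-↑ˡ (m ℕ.* n) u))))
                   (Σ-zero (m ℕ.* n) (λ y → inGroup-no 0 _ (λ e → ℕP.0≢1+n (trans e (group-↑ʳ y))))) ⟩
    Σ n (λ _ → + 1) + + 0   ≡⟨ ℤP.+-identityʳ _ ⟩
    Σ n (λ _ → + 1)         ≡⟨ Σ-const n (+ 1) ⟩
    + n * + 1               ≡⟨ ℤP.*-identityʳ (+ n) ⟩
    + n                     ∎
    where open ≡-Reasoning
  group-size (suc m) (suc g) (s≤s g<m) = begin
    Σ (n ℕ.+ m ℕ.* n) (inGroup (suc g))
      ≡⟨ Σ-split n (m ℕ.* n) (inGroup (suc g)) ⟩
    Σ n (λ u → inGroup (suc g) (u ↑ˡ m ℕ.* n)) + Σ (m ℕ.* n) (λ y → inGroup (suc g) (n ↑ʳ y))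
      ≡⟨ cong₂ _+_ (Σ-zero n (λ u → inGroup-no (suc g) _ (λ e → ℕP.1+n≢0 (trans e (group-↑ˡ (m ℕ.* n) u)))))
                   (Σ-cong (m ℕ.* n) shift) ⟩
    + 0 + Σ (m ℕ.* n) (inGroup g)  ≡⟨ ℤP.+-identityˡ _ ⟩
    Σ (m ℕ.* n) (inGroup g)        ≡⟨ group-size m g g<m ⟩
    + n                            ∎
    where
    open ≡-Reasoning
    shift : ∀ (y : Fin (m ℕ.* n)) → inGroup (suc g) (n ↑ʳ y) ≡ inGroup g y
    shift y = decide (g ℕ.≟ group y)
      (λ e → trans (inGroup-yes (suc g) (n ↑ʳ y) (trans (cong suc e) (sym (group-↑ʳ y))))
                   (sym (inGroup-yes g y e)))
      (λ ne → trans (inGroup-no (suc g) (n ↑ʳ y) (λ e → ne (ℕP.suc-injective (trans e (group-↑ʳ y)))))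
                    (sym (inGroup-no g y ne)))

  K-row-sum : ∀ m (x : Fin (m ℕ.* n)) → Σ (m ℕ.* n) (K m n x) ≡ + n
  K-row-sum m x = trans (Σ-cong (m ℕ.* n) K≡inGroup) (group-size m (group x) (group< m x))
    where
    K≡inGroup : ∀ y → K m n x y ≡ inGroup (group x) y
    K≡inGroup y = decide (group x ℕ.≟ group y)
      (λ e → trans (K-yes m x y e) (sym (inGroup-yes (group x) y e)))
      (λ ne → trans (K-no m x y ne) (sym (inGroup-no (group x) y ne)))

  K·K : ∀ m (x y : Fin (m ℕ.* n)) → (K m n · K m n) x y ≡ + n * K m n x y
  K·K m x y = trans (Σ-cong (m ℕ.* n) factor)
    (trans (Σ-*ˡ (m ℕ.* n) (K m n x y) (K m n x))
           (trans (cong (K m n x y *_) (K-row-sum m x)) (ℤP.*-comm (K m n x y) (+ n))))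
    where
    factor : ∀ z → K m n x z * K m n z y ≡ K m n x y * K m n x z
    factor z = decide (group x ℕ.≟ group z)
      (λ x~z → trans (cong₂ _*_ (K-yes m x z x~z) (K-group m x z y x~z))
                     (trans (ℤP.*-comm (+ 1) _) (cong (K m n x y *_) (sym (K-yes m x z x~z)))))
      (λ x≁z → trans (cong (_* K m n z y) (K-no m x z x≁z))
                     (trans (sym (ℤP.*-zeroʳ (K m n x y))) (cong (K m n x y *_) (sym (K-no m x z x≁z)))))

  K·J : ∀ m (x y : Fin (m ℕ.* n)) → (K m n · J (m ℕ.* n)) x y ≡ + n
  K·J m x y = trans (Σ-cong (m ℕ.* n) (λ z → ℤP.*-identityʳ (K m n x z))) (K-row-sum m x)

  J·K : ∀ m (x y : Fin (m ℕ.* n)) → (J (m ℕ.* n) · K m n) x y ≡ + n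
  J·K m x y = trans (Σ-cong (m ℕ.* n) (λ z → trans (ℤP.*-identityˡ (K m n z y)) (K-sym m z y)))
                    (K-row-sum m y)

  J·J : ∀ m (x y : Fin (m ℕ.* n)) → (J (m ℕ.* n) · J (m ℕ.* n)) x y ≡ + (m ℕ.* n)
  J·J m x y = trans (Σ-const (m ℕ.* n) (+ 1 * + 1)) (ℤP.*-identityʳ (+ (m ℕ.* n)))

  -- K with the diagonal block of the group of z₀ removed; it is n times the orthogonal
  -- projection onto the vectors that are constant on groups and vanish on that group
  K-without : ∀ m (z₀ : Fin (m ℕ.* n)) → Mat (m ℕ.* n)
  K-without m z₀ p q = K m n p q - K m n z₀ p * K m n z₀ q

  module _ (m : ℕ) (z₀ : Fin (m ℕ.* n)) where

    private
      Π : Mat (m ℕ.* n)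
      Π = K-without m z₀
      k₀ : Fin (m ℕ.* n) → ℤ
      k₀ = K m n z₀

      k₀-square : ∀ p → k₀ p * k₀ p ≡ k₀ p
      k₀-square p = decide (group z₀ ℕ.≟ group p)
        (λ e → trans (cong (λ c → c * c) (K-yes m z₀ p e)) (sym (K-yes m z₀ p e)))
        (λ e → trans (cong (λ c → c * c) (K-no m z₀ p e)) (sym (K-no m z₀ p e)))

      Σk₀² : Σ (m ℕ.* n) (λ r → k₀ r * k₀ r) ≡ + n
      Σk₀² = trans (Σ-cong (m ℕ.* n) k₀-square) (K-row-sum m z₀)

      Σ-K-k₀ : ∀ p → Σ (m ℕ.* n) (λ r → K m n p r * k₀ r) ≡ + n * k₀ p
      Σ-K-k₀ p = trans (Σ-cong (m ℕ.* n) (λ r → cong (K m n p r *_) (K-sym m z₀ r)))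
                       (trans (K·K m p z₀) (cong (+ n *_) (K-sym m p z₀)))

    K-without-sym : ∀ p q → Π p q ≡ Π q p
    K-without-sym p q = cong₂ _-_ (K-sym m p q) (ℤP.*-comm (k₀ p) (k₀ q))

    K-without-block : ∀ p → group p ≡ group z₀ → Π p p ≡ + 0
    K-without-block p p~z₀ = cong₂ (λ a b → a - b * b) (K-refl m p) (K-yes m z₀ p (sym p~z₀))

    K-without-square : ∀ p q → (Π · Π) p q ≡ + n * Π p q
    K-without-square p q = begin
      (Π · Π) p q
        ≡⟨ Σ-diff-product N (K m n p) (λ r → k₀ p * k₀ r) (λ r → K m n r q) (λ r → k₀ r * k₀ q) ⟩
      (K m n · K m n) p q - Σ N (λ r → K m n p r * (k₀ r * k₀ q)) - Σ N (λ r → (k₀ p * k₀ r) * K m n r q)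
        + Σ N (λ r → (k₀ p * k₀ r) * (k₀ r * k₀ q))
        ≡⟨ cong₂ _+_ (cong₂ _-_ (cong₂ _-_ (K·K m p q) Kk₀k₀) k₀k₀K) k₀k₀k₀k₀ ⟩
      + n * K m n p q - + n * k₀ p * k₀ q - k₀ p * (+ n * k₀ q) + k₀ p * k₀ q * + n
        ≡⟨ collect (+ n) (K m n p q) (k₀ p) (k₀ q) ⟩
      + n * Π p q ∎
      where
      open ≡-Reasoning
      N : ℕ
      N = m ℕ.* n
      Kk₀k₀ : Σ N (λ r → K m n p r * (k₀ r * k₀ q)) ≡ + n * k₀ p * k₀ q
      Kk₀k₀ = trans (Σ-cong N (λ r → sym (ℤP.*-assoc (K m n p r) (k₀ r) (k₀ q))))
                    (trans (Σ-*ʳ N (k₀ q) (λ r → K m n p r * k₀ r)) (cong (_* k₀ q) (Σ-K-k₀ p)))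
      k₀k₀K : Σ N (λ r → (k₀ p * k₀ r) * K m n r q) ≡ k₀ p * (+ n * k₀ q)
      k₀k₀K = trans (Σ-cong N (λ r → trans (ℤP.*-assoc (k₀ p) (k₀ r) (K m n r q))
                                           (cong (k₀ p *_) (trans (ℤP.*-comm (k₀ r) _) (cong (_* k₀ r) (K-sym m r q))))))
                    (trans (Σ-*ˡ N (k₀ p) _) (cong (k₀ p *_) (Σ-K-k₀ q)))
      k₀k₀k₀k₀ : Σ N (λ r → (k₀ p * k₀ r) * (k₀ r * k₀ q)) ≡ k₀ p * k₀ q * + n
      k₀k₀k₀k₀ = trans (Σ-cong N (λ r → regroup (k₀ p) (k₀ r) (k₀ q)))
                       (trans (Σ-*ˡ N (k₀ p * k₀ q) (λ r → k₀ r * k₀ r)) (cong (k₀ p * k₀ q *_) Σk₀²))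
        where
        regroup : ∀ a b c → (a * b) * (b * c) ≡ (a * c) * (b * b)
        regroup = solve-∀
      collect : ∀ n a b c → n * a - n * b * c - b * (n * c) + b * c * n ≡ n * (a - b * c)
      collect = solve-∀

    K-without-trace : tr Π ≡ + (m ℕ.* n) - + n
    K-without-trace = trans (Σ-- (m ℕ.* n) (λ p → K m n p p) (λ p → k₀ p * k₀ p))
      (cong₂ _-_ (trans (Σ-cong (m ℕ.* n) (K-refl m)) (trans (Σ-const (m ℕ.* n) (+ 1)) (ℤP.*-identityʳ (+ (m ℕ.* n))))) Σk₀²)

-- The algebra spanned by I, K and J on m groups of size n: it is closed under products
-- (using K² = nK, KJ = JK = nJ, J² = mnJ), which lets us compute Gram matrices in it.

module _ (n : ℕ) .{{_ : NonZero n}} (m : ℕ) where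

  ikj : ℤ → ℤ → ℤ → Mat (m ℕ.* n)
  ikj p q r = comb p δ q (K m n) r (J (m ℕ.* n))

  ikj-product : ∀ p q r p′ q′ r′ x y → (ikj p q r · ikj p′ q′ r′) x y ≡
    ikj (p * p′) (p * q′ + q * p′ + + n * q * q′)
        (p * r′ + r * p′ + + n * q * r′ + + n * r * q′ + + (m ℕ.* n) * r * r′) x y
  ikj-product p q r p′ q′ r′ x y = begin
    (ikj p q r · L′) x y
      ≡⟨ ·-combˡ p δ q (K m n) r (J N) L′ x y ⟩
    p * (δ · L′) x y + q * (K m n · L′) x y + r * (J N · L′) x y
      ≡⟨ cong₂ _+_ (cong₂ _+_ (cong (p *_) (·-δˡ L′ x y)) (cong (q *_) K·L′)) (cong (r *_) J·L′) ⟩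
    p * L′ x y + q * (p′ * K m n x y + q′ * (+ n * K m n x y) + r′ * + n) + r * (p′ * + 1 + q′ * + n + r′ * + N)
      ≡⟨ collect p q r p′ q′ r′ (δ x y) (K m n x y) (+ n) (+ N) ⟩
    ikj (p * p′) (p * q′ + q * p′ + + n * q * q′) (p * r′ + r * p′ + + n * q * r′ + + n * r * q′ + + N * r * r′) x y ∎
    where
    open ≡-Reasoning
    N : ℕ
    N = m ℕ.* n
    L′ : Mat (m ℕ.* n)
    L′ = ikj p′ q′ r′
    K·L′ : (K m n · L′) x y ≡ p′ * K m n x y + q′ * (+ n * K m n x y) + r′ * + n
    K·L′ = trans (·-combʳ (K m n) p′ δ q′ (K m n) r′ (J N) x y)
      (cong₂ _+_ (cong₂ _+_ (cong (p′ *_) (·-δʳ (K m n) x y)) (cong (q′ *_) (K·K n m x y)))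
                 (cong (r′ *_) (K·J n m x y)))
    J·L′ : (J N · L′) x y ≡ p′ * + 1 + q′ * + n + r′ * + N
    J·L′ = trans (·-combʳ (J N) p′ δ q′ (K m n) r′ (J N) x y)
      (cong₂ _+_ (cong₂ _+_ (cong (p′ *_) (·-δʳ (J N) x y)) (cong (q′ *_) (J·K n m x y)))
                 (cong (r′ *_) (J·J n m x y)))
    collect : ∀ p q r p′ q′ r′ d k n N →
      p * (p′ * d + q′ * k + r′ * + 1) + q * (p′ * k + q′ * (n * k) + r′ * n) + r * (p′ * + 1 + q′ * n + r′ * N)
      ≡ p * p′ * d + (p * q′ + q * p′ + n * q * q′) * k + (p * r′ + r * p′ + n * q * r′ + n * r * q′ + N * r * r′) * + 1
    collect = solve-∀

  ikj-diag : ∀ p q r x → ikj p q r x x ≡ p + q + r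
  ikj-diag p q r x = trans (cong₂ (λ a b → p * a + q * b + r * + 1) (δ-refl x) (K-refl n m x)) (unit p q r)
    where
    unit : ∀ p q r → p * + 1 + q * + 1 + r * + 1 ≡ p + q + r
    unit = solve-∀

  ikj-trace : ∀ p q r → tr (ikj p q r) ≡ + (m ℕ.* n) * (p + q + r)
  ikj-trace p q r = trans (Σ-cong (m ℕ.* n) (ikj-diag p q r)) (Σ-const (m ℕ.* n) (p + q + r))

  ikj-sym : ∀ p q r x y → ikj p q r x y ≡ ikj p q r y x
  ikj-sym p q r x y = cong₂ (λ a b → p * a + q * b + r * + 1) (δ-sym x y) (K-sym n m x y)

  ikj-scale : ∀ c p q r x y → ikj (c * p) (c * q) (c * r) x y ≡ c * ikj p q r x y
  ikj-scale c p q r x y = distrib c p q r (δ x y) (K m n x y)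
    where
    distrib : ∀ c p q r d k → (c * p) * d + (c * q) * k + (c * r) * + 1 ≡ c * (p * d + q * k + r * + 1)
    distrib = solve-∀

  ikj-product-≡ : ∀ p q r p′ q′ r′ P Q R →
    p * p′ ≡ P → p * q′ + q * p′ + + n * q * q′ ≡ Q →
    p * r′ + r * p′ + + n * q * r′ + + n * r * q′ + + (m ℕ.* n) * r * r′ ≡ R →
    ∀ x y → (ikj p q r · ikj p′ q′ r′) x y ≡ ikj P Q R x y
  ikj-product-≡ p q r p′ q′ r′ _ _ _ refl refl refl = ikj-product p q r p′ q′ r′

module Sandwich {P v : ℕ} (X : Matrix P v) (W : Matrix P P) (W-sym : ∀ a b → W a b ≡ W b a) where

  G : Matrix P P
  G = X · X ᵀ

  M : Matrix v v
  M = X ᵀ · (W · X)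

  M-sym : ∀ p q → M p q ≡ M q p
  M-sym p q = sym (begin
    M q p                   ≡⟨ ·-transpose (X ᵀ) (W · X) p q ⟩
    ((W · X) ᵀ · X) p q     ≡⟨ ·-congˡ X (λ p′ a → trans (·-transpose W X p′ a)
                                                         (·-congʳ (X ᵀ) (λ u w → W-sym w u) p′ a)) p q ⟩
    (X ᵀ · W · X) p q       ≡⟨ ·-assoc (X ᵀ) W X p q ⟩
    M p q                   ∎)
    where open ≡-Reasoning

  M-trace : tr M ≡ tr (W · G)
  M-trace = trans (tr-cyclic (X ᵀ) (W · X)) (Σ-cong P (λ a → ·-assoc W X (X ᵀ) a a))

  M-idem : ∀ d → (∀ a b → (W · G · W) a b ≡ d * W a b) → ∀ p q → (M · M) p q ≡ d * M p q
  M-idem d WGW≡dW p q = begin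
    (M · M) p q                     ≡⟨ ·-assoc (X ᵀ) (W · X) M p q ⟩
    (X ᵀ · (W · X · M)) p q         ≡⟨ ·-congʳ (X ᵀ) WXM≡dWX p q ⟩
    (X ᵀ · (λ a w → d * (W · X) a w)) p q ≡⟨ ·-scaleʳ (X ᵀ) d (W · X) p q ⟩
    d * M p q                       ∎
    where
    open ≡-Reasoning
    WXM≡dWX : ∀ a w → (W · X · M) a w ≡ d * (W · X) a w
    WXM≡dWX a w = begin
      (W · X · M) a w              ≡⟨ sym (·-assoc (W · X) (X ᵀ) (W · X) a w) ⟩
      (W · X · X ᵀ · (W · X)) a w  ≡⟨ ·-congˡ (W · X) (·-assoc W X (X ᵀ)) a w ⟩
      (W · G · (W · X)) a w        ≡⟨ sym (·-assoc (W · G) W X a w) ⟩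
      (W · G · W · X) a w          ≡⟨ ·-congˡ X WGW≡dW a w ⟩
      ((λ u b → d * W u b) · X) a w ≡⟨ ·-scaleˡ d W X a w ⟩
      d * (W · X) a w              ∎

  M-zero : ∀ p → (∀ a → X a p ≡ + 0) → M p p ≡ + 0
  M-zero p column≡0 = Σ-zero P (λ a → trans (cong (_* (W · X) a p) (column≡0 a)) (ℤP.*-zeroˡ ((W · X) a p)))

f≤m-from-E≢0 : ∀ f m n → 1 ℕ.< n → + (f ℕ.* n) - + 1 ≤ + (m ℕ.* n) → f ℕ.≤ m
f≤m-from-E≢0 f m n 1<n h = decide (f ℕ.≤? m) (λ f≤m → f≤m)
  (λ f≰m → ⊥-elim (ℕP.<⇒≱ 1<n (ℕP.+-cancelʳ-≤ (m ℕ.* n) n 1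
    (ℕP.≤-trans (ℕP.*-monoˡ-≤ n (ℕP.≰⇒> f≰m)) (ℕP.≤-trans fn≤mn+1 (ℕP.≤-reflexive (ℕP.+-comm (m ℕ.* n) 1)))))))
  where
  fn≤mn+1 : f ℕ.* n ℕ.≤ m ℕ.* n ℕ.+ 1
  fn≤mn+1 = ℤP.drop‿+≤+ (subst₂ _≤_ (undo (+ (f ℕ.* n))) (sym (ℤP.pos-+ (m ℕ.* n) 1)) (ℤP.+-monoˡ-≤ (+ 1) h))
    where
    undo : ∀ a → a - + 1 + + 1 ≡ a
    undo = solve-∀

-- f (n - 1) + m ≤ m n, i.e. f (n - 1) ≤ m (n - 1)
f≤m-from-E≡0 : ∀ f m n → 1 ℕ.< n → + f * (+ n - + 1) + + m ≤ + (m ℕ.* n) → f ℕ.≤ m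
f≤m-from-E≡0 f m n 1<n h = ℤP.drop‿+≤+ (ℤP.*-cancelʳ-≤-pos (+ f) (+ m) (+ n - + 1) {{ℤ.positive (0<n-1 1<n)}}
  (ℤP.0≤i-j⇒j≤i (subst (+ 0 ≤_) (trans (cong (_- (+ f * (+ n - + 1) + + m)) (ℤP.pos-* m n)) (regroup (+ f) (+ m) (+ n)))
                                 (ℤP.i≤j⇒0≤j-i h))))
  where
  regroup : ∀ f m n → m * n - (f * (n - + 1) + m) ≡ m * (n - + 1) - f * (n - + 1)
  regroup = solve-∀

-- From now on we fix a linked system of type II on m = m′+1 groups of size n, indexed
-- by Fin (f′+1), whose members satisfy A_{j,i} = A_{i,j}ᵀ.

module LinkedSystem (f′ m′ n : ℕ) .{{_ : NonZero n}} (k λ₁ λ₂ σ τ ρ : ℕ)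
  (A : Fin (suc f′) → Fin (suc f′) → Mat (suc m′ ℕ.* n))
  (design : ∀ i j → i ≢ j → IsSGDD (suc m′) n k λ₁ λ₂ (A i j))
  (blocks01 : ∀ i j → i ≢ j → IsZeroOne (λ x y → A i j x y + K (suc m′) n x y))
  (linked : ∀ i j l → i ≢ j → j ≢ l → i ≢ l → ∀ x y →
     (A i j ⊗ A j l) x y ≡ (+ σ) * A i l x y + (+ τ) * (J (suc m′ ℕ.* n) x y - A i l x y - K (suc m′) n x y)
                           + (+ ρ) * K (suc m′) n x y)
  (transposed : ∀ i j → i ≢ j → ∀ x y → A j i x y ≡ A i j y x) where

  m v : ℕ
  m = suc m′
  v = m ℕ.* n

  n≢0 : + n ≢ + 0
  n≢0 n≡0 = ℕ.≢-nonZero⁻¹ n (ℤP.+-injective n≡0)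

  Kv Jv : Mat v
  Kv = K m n
  Jv = J v

  α β s u : ℤ
  α = + k - + λ₁
  β = + λ₁ - + ρ
  s = + σ - + τ
  u = + ρ - + τ

  -- the coefficients of A Aᵀ = Aᵀ A = α I + λ₁₂ K + λ₂ J
  λ₁₂ : ℤ
  λ₁₂ = + λ₁ - + λ₂

  coefficient-sum : α + λ₁₂ + + λ₂ ≡ + k
  coefficient-sum = telescope (+ k) (+ λ₁) (+ λ₂)
    where
    telescope : ∀ k l₁ l₂ → (k - l₁) + (l₁ - l₂) + l₂ ≡ k
    telescope = solve-∀

  entry01 : ∀ i j → i ≢ j → ∀ x y → (A i j x y ≡ + 0) ⊎ (A i j x y ≡ + 1)
  entry01 i j i≢j = proj₁ (design i j i≢j)

  entry-square : ∀ i j → i ≢ j → ∀ x y → A i j x y * A i j x y ≡ A i j x y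
  entry-square i j i≢j x y with entry01 i j i≢j x y
  ... | inj₁ e = trans (cong₂ _*_ e e) (sym e)
  ... | inj₂ e = trans (cong₂ _*_ e e) (sym e)

  -- A + K is a (0,1)-matrix, so A vanishes on the diagonal blocks
  zero-on-blocks : ∀ i j → i ≢ j → ∀ x y → Kv x y ≡ + 1 → A i j x y ≡ + 0
  zero-on-blocks i j i≢j x y K≡1 with entry01 i j i≢j x y | blocks01 i j i≢j x y
  ... | inj₁ A≡0 | _ = A≡0
  ... | inj₂ A≡1 | inj₁ sum≡0 = ⊥-elim (2≢0 (trans (sym (cong₂ _+_ A≡1 K≡1)) sum≡0))
    where
    2≢0 : + 2 ≢ + 0
    2≢0 ()
  ... | inj₂ A≡1 | inj₂ sum≡1 = ⊥-elim (2≢1 (trans (sym (cong₂ _+_ A≡1 K≡1)) sum≡1))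
    where
    2≢1 : + 2 ≢ + 1
    2≢1 ()

  design-rhs : ∀ x y → + k * δ x y + + λ₁ * (Kv x y - δ x y) + + λ₂ * (Jv x y - Kv x y)
                     ≡ ikj n m α λ₁₂ (+ λ₂) x y
  design-rhs x y = regroup (+ k) (+ λ₁) (+ λ₂) (δ x y) (Kv x y)
    where
    regroup : ∀ k l₁ l₂ d c → k * d + l₁ * (c - d) + l₂ * (+ 1 - c) ≡ (k - l₁) * d + (l₁ - l₂) * c + l₂ * + 1
    regroup = solve-∀

  AAᵀ : ∀ i j → i ≢ j → ∀ x y → (A i j · A i j ᵀ) x y ≡ ikj n m α λ₁₂ (+ λ₂) x y
  AAᵀ i j i≢j x y = trans (proj₁ (proj₂ (design i j i≢j)) x y) (design-rhs x y)

  AᵀA : ∀ i j → i ≢ j → ∀ x y → (A i j ᵀ · A i j) x y ≡ ikj n m α λ₁₂ (+ λ₂) x y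
  AᵀA i j i≢j x y = trans (proj₂ (proj₂ (design i j i≢j)) x y) (design-rhs x y)

  AA : ∀ i j l → i ≢ j → j ≢ l → i ≢ l → ∀ x y → (A i j · A j l) x y ≡ s * A i l x y + + τ * + 1 + u * Kv x y
  AA i j l i≢j j≢l i≢l x y = trans (linked i j l i≢j j≢l i≢l x y) (regroup (+ σ) (+ τ) (+ ρ) (A i l x y) (Kv x y))
    where
    regroup : ∀ σ τ ρ a c → σ * a + τ * (+ 1 - a - c) + ρ * c ≡ (σ - τ) * a + τ * + 1 + (ρ - τ) * c
    regroup = solve-∀

  A·J : ∀ i j → i ≢ j → ∀ x y → (A i j · Jv) x y ≡ + k
  A·J i j i≢j x y = begin
    (A i j · Jv) x y        ≡⟨ Σ-cong v (λ z → trans (ℤP.*-identityʳ (A i j x z)) (sym (entry-square i j i≢j x z))) ⟩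
    (A i j · A i j ᵀ) x x   ≡⟨ AAᵀ i j i≢j x x ⟩
    ikj n m α λ₁₂ (+ λ₂) x x  ≡⟨ ikj-diag n m α λ₁₂ (+ λ₂) x ⟩
    α + λ₁₂ + + λ₂          ≡⟨ coefficient-sum ⟩
    + k                     ∎
    where open ≡-Reasoning

  J·A : ∀ i j → i ≢ j → ∀ x y → (Jv · A i j) x y ≡ + k
  J·A i j i≢j x y = begin
    (Jv · A i j) x y        ≡⟨ Σ-cong v (λ z → trans (ℤP.*-identityˡ (A i j z y)) (sym (entry-square i j i≢j z y))) ⟩
    (A i j ᵀ · A i j) y y   ≡⟨ AᵀA i j i≢j y y ⟩
    ikj n m α λ₁₂ (+ λ₂) y y  ≡⟨ ikj-diag n m α λ₁₂ (+ λ₂) y ⟩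
    α + λ₁₂ + + λ₂          ≡⟨ coefficient-sum ⟩
    + k                     ∎
    where open ≡-Reasoning

  -- Row x of A_{i,j}K counts, for every group, the ones of row x
  -- of A_{i,j} in that group; A_{i,j} is tactical when these counts depend only on the
  -- group of x.  This is what the case E = 0 needs; it follows from three cases below.

  Tactical : Fin (suc f′) → Fin (suc f′) → Set
  Tactical i j = ∀ x x′ q → group n x ≡ group n x′ → (A i j · Kv) x q ≡ (A i j · Kv) x′ q

  K·-group : ∀ {c} (C : Matrix v c) x x′ q → group n x ≡ group n x′ → (Kv · C) x q ≡ (Kv · C) x′ q
  K·-group C x x′ q x~x′ = Σ-cong v (λ z → cong (_* C z q) (sym (K-group n m x x′ z x~x′)))

  -- A_{i,j}(A_{j,l} A_{l,j}) = (A_{i,j} A_{j,l}) A_{l,j}, both sides expanded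
  triple-product : ∀ i j l → i ≢ j → j ≢ l → i ≢ l → ∀ x y →
    comb α (A i j) λ₁₂ (A i j · Kv) (+ λ₂ * + k) Jv x y
    ≡ comb s (comb s (A i j) (+ τ) Jv u Kv) (+ τ * + k) Jv u (Kv · A l j) x y
  triple-product i j l i≢j j≢l i≢l x y = begin
    comb α (A i j) λ₁₂ (A i j · Kv) (+ λ₂ * + k) Jv x y
      ≡⟨ sym first-pair ⟩
    (A i j · (A j l · A l j)) x y
      ≡⟨ sym (·-assoc (A i j) (A j l) (A l j) x y) ⟩
    (A i j · A j l · A l j) x y
      ≡⟨ ·-congˡ (A l j) (AA i j l i≢j j≢l i≢l) x y ⟩
    (comb s (A i l) (+ τ) Jv u Kv · A l j) x y
      ≡⟨ ·-combˡ s (A i l) (+ τ) Jv u Kv (A l j) x y ⟩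
    s * (A i l · A l j) x y + + τ * (Jv · A l j) x y + u * (Kv · A l j) x y
      ≡⟨ cong₂ (λ a b → s * a + + τ * b + u * (Kv · A l j) x y)
               (AA i l j i≢l (≢-sym j≢l) i≢j x y) (J·A l j (≢-sym j≢l) x y) ⟩
    s * comb s (A i j) (+ τ) Jv u Kv x y + + τ * + k + u * (Kv · A l j) x y
      ≡⟨ cong (λ a → s * comb s (A i j) (+ τ) Jv u Kv x y + a + u * (Kv · A l j) x y)
              (sym (ℤP.*-identityʳ (+ τ * + k))) ⟩
    comb s (comb s (A i j) (+ τ) Jv u Kv) (+ τ * + k) Jv u (Kv · A l j) x y ∎
    where
    open ≡-Reasoning
    first-pair : (A i j · (A j l · A l j)) x y ≡ comb α (A i j) λ₁₂ (A i j · Kv) (+ λ₂ * + k) Jv x y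
    first-pair = begin
      (A i j · (A j l · A l j)) x y
        ≡⟨ ·-congʳ (A i j) (λ a b → trans (·-congʳ (A j l) (transposed j l j≢l) a b) (AAᵀ j l j≢l a b)) x y ⟩
      (A i j · ikj n m α λ₁₂ (+ λ₂)) x y
        ≡⟨ ·-combʳ (A i j) α δ λ₁₂ Kv (+ λ₂) Jv x y ⟩
      α * (A i j · δ) x y + λ₁₂ * (A i j · Kv) x y + + λ₂ * (A i j · Jv) x y
        ≡⟨ cong₂ (λ a b → α * a + λ₁₂ * (A i j · Kv) x y + + λ₂ * b) (·-δʳ (A i j) x y) (A·J i j i≢j x y) ⟩
      α * A i j x y + λ₁₂ * (A i j · Kv) x y + + λ₂ * + k
        ≡⟨ cong (λ a → α * A i j x y + λ₁₂ * (A i j · Kv) x y + a) (sym (ℤP.*-identityʳ (+ λ₂ * + k))) ⟩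
      comb α (A i j) λ₁₂ (A i j · Kv) (+ λ₂ * + k) Jv x y ∎

  κ : ℤ
  κ = α + λ₁₂ * + n - s * s

  -- the triple product multiplied by K on the right: κ·A_{i,j}K is a combination of J, K
  -- and K A_{l,j} K, all of whose rows are constant on groups
  κ·AK : ∀ i j l → i ≢ j → j ≢ l → i ≢ l → ∀ x q →
    κ * (A i j · Kv) x q ≡ + n * (s * + τ + + τ * + k - + λ₂ * + k) + s * u * + n * Kv x q
                           + u * (Kv · A l j · Kv) x q
  κ·AK i j l i≢j j≢l i≢l x q = begin
    κ * AK
      ≡⟨ isolate (+ k) (+ λ₁) (+ λ₂) (+ n) s AK ⟩
    (α * AK + λ₁₂ * (+ n * AK) + (+ λ₂ * + k) * + n) - s * s * AK - (+ λ₂ * + k) * + n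
      ≡⟨ cong (λ z → z - s * s * AK - (+ λ₂ * + k) * + n)
              (trans (sym left·K) (trans (·-congˡ Kv (triple-product i j l i≢j j≢l i≢l) x q) right·K)) ⟩
    (s * (s * AK + + τ * + n + u * (+ n * Kv x q)) + (+ τ * + k) * + n + u * KAK) - s * s * AK - (+ λ₂ * + k) * + n
      ≡⟨ collect (+ k) (+ λ₂) (+ n) s (+ τ) u AK (Kv x q) KAK ⟩
    + n * (s * + τ + + τ * + k - + λ₂ * + k) + s * u * + n * Kv x q + u * KAK ∎
    where
    open ≡-Reasoning
    P : Mat v
    P = A i j
    AK KAK : ℤ
    AK = (P · Kv) x q
    KAK = (Kv · A l j · Kv) x q
    left·K : (comb α P λ₁₂ (P · Kv) (+ λ₂ * + k) Jv · Kv) x q ≡ α * AK + λ₁₂ * (+ n * AK) + (+ λ₂ * + k) * + n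
    left·K = trans (·-combˡ α P λ₁₂ (P · Kv) (+ λ₂ * + k) Jv Kv x q)
      (cong₂ (λ a b → α * AK + λ₁₂ * a + (+ λ₂ * + k) * b)
        (trans (·-assoc P Kv Kv x q) (trans (·-congʳ P (K·K n m) x q) (·-scaleʳ P (+ n) Kv x q)))
        (J·K n m x q))
    right·K : (comb s (comb s P (+ τ) Jv u Kv) (+ τ * + k) Jv u (Kv · A l j) · Kv) x q
              ≡ s * (s * AK + + τ * + n + u * (+ n * Kv x q)) + (+ τ * + k) * + n + u * KAK
    right·K = trans (·-combˡ s (comb s P (+ τ) Jv u Kv) (+ τ * + k) Jv u (Kv · A l j) Kv x q)
      (cong₂ (λ a b → s * a + (+ τ * + k) * b + u * KAK)
        (trans (·-combˡ s P (+ τ) Jv u Kv Kv x q)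
               (cong₂ (λ a b → s * AK + + τ * a + u * b) (J·K n m x q) (K·K n m x q)))
        (J·K n m x q))
    isolate : ∀ k l₁ l₂ n s a → ((k - l₁) + (l₁ - l₂) * n - s * s) * a
              ≡ ((k - l₁) * a + (l₁ - l₂) * (n * a) + (l₂ * k) * n) - s * s * a - (l₂ * k) * n
    isolate = solve-∀
    collect : ∀ k l₂ n s t u a c b → (s * (s * a + t * n + u * (n * c)) + (t * k) * n + u * b) - s * s * a - (l₂ * k) * n
              ≡ n * (s * t + t * k - l₂ * k) + s * u * n * c + u * b
    collect = solve-∀

  tactical-κ≢0 : ∀ i j l → i ≢ j → j ≢ l → i ≢ l → κ ≢ + 0 → Tactical i j
  tactical-κ≢0 i j l i≢j j≢l i≢l κ≢0 x x′ q x~x′ =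
    ℤP.*-cancelˡ-≡ κ _ _ {{ℤ.≢-nonZero κ≢0}}
      (trans (κ·AK i j l i≢j j≢l i≢l x q)
        (trans (cong₂ (λ a b → + n * (s * + τ + + τ * + k - + λ₂ * + k) + s * u * + n * a + u * b)
                      (sym (K-group n m x x′ q x~x′))
                      (trans (·-assoc Kv (A l j) Kv x q)
                             (trans (K·-group (A l j · Kv) x x′ q x~x′) (sym (·-assoc Kv (A l j) Kv x′ q)))))
               (sym (κ·AK i j l i≢j j≢l i≢l x′ q))))

  -- The case E = 0, where E = α + n(λ₁ - ρ) is the eigenvalue of the Gram matrix X Xᵀ
  -- (computed later) on vectors constant on groups and orthogonal to J.

  E : ℤ
  E = α + + n * β

  K·Z·K-local : ∀ x (Z Z′ : Mat v) →
    (∀ z w → group n z ≡ group n x → group n w ≡ group n x → Z z w ≡ Z′ z w) →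
    (Kv · Z · Kv) x x ≡ (Kv · Z′ · Kv) x x
  K·Z·K-local x Z Z′ agree = trans (·-assoc Kv Z Kv x x) (trans outer (sym (·-assoc Kv Z′ Kv x x)))
    where
    inner : ∀ z → group n z ≡ group n x → (Z · Kv) z x ≡ (Z′ · Kv) z x
    inner z z~x = Σ-cong v (λ w → decide (group n w ℕ.≟ group n x)
      (λ w~x → cong (_* Kv w x) (agree z w z~x w~x))
      (λ w≁x → trans (cong (Z z w *_) (K-no n m w x w≁x))
                     (trans (ℤP.*-zeroʳ (Z z w)) (sym (trans (cong (Z′ z w *_) (K-no n m w x w≁x)) (ℤP.*-zeroʳ (Z′ z w)))))))
    outer : (Kv · (Z · Kv)) x x ≡ (Kv · (Z′ · Kv)) x x
    outer = Σ-cong v (λ z → decide (group n x ℕ.≟ group n z)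
      (λ x~z → cong (Kv x z *_) (inner z (sym x~z)))
      (λ x≁z → trans (cong (_* (Z · Kv) z x) (K-no n m x z x≁z)) (sym (cong (_* (Z′ · Kv) z x) (K-no n m x z x≁z)))))

  K·ikj·K : ∀ P Q x → (Kv · ikj n m P (+ 0) Q · Kv) x x ≡ + n * P + + n * + n * Q
  K·ikj·K P Q x = begin
    (Kv · L · Kv) x x                                  ≡⟨ ·-assoc Kv L Kv x x ⟩
    (Kv · (L · Kv)) x x                                ≡⟨ ·-congʳ Kv L·K x x ⟩
    (Kv · comb P Kv (+ 0) Kv (Q * + n) Jv) x x         ≡⟨ ·-combʳ Kv P Kv (+ 0) Kv (Q * + n) Jv x x ⟩
    P * (Kv · Kv) x x + + 0 * (Kv · Kv) x x + (Q * + n) * (Kv · Jv) x x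
      ≡⟨ cong₂ (λ a b → P * a + + 0 * a + (Q * + n) * b)
               (trans (K·K n m x x) (cong (+ n *_) (K-refl n m x))) (K·J n m x x) ⟩
    P * (+ n * + 1) + + 0 * (+ n * + 1) + (Q * + n) * + n ≡⟨ collect P Q (+ n) ⟩
    + n * P + + n * + n * Q                            ∎
    where
    open ≡-Reasoning
    L : Mat v
    L = ikj n m P (+ 0) Q
    L·K : ∀ a b → (L · Kv) a b ≡ comb P Kv (+ 0) Kv (Q * + n) Jv a b
    L·K a b = trans (·-combˡ P δ (+ 0) Kv Q Jv Kv a b)
      (trans (cong₂ (λ c d → P * c + + 0 * (Kv · Kv) a b + Q * d) (·-δˡ Kv a b) (J·K n m a b))
             (regroup P (Kv a b) Q (+ n) ((Kv · Kv) a b)))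
      where
      regroup : ∀ P c Q n z → P * c + + 0 * z + Q * n ≡ P * c + + 0 * c + (Q * n) * + 1
      regroup = solve-∀
    collect : ∀ P Q n → P * (n * + 1) + + 0 * (n * + 1) + (Q * n) * n ≡ n * P + n * n * Q
    collect = solve-∀

  D : Fin (suc f′) → Fin (suc f′) → Fin (suc f′) → Mat v
  D a b l z w = A a l z w - A b l z w

  -- on a diagonal block, D Dᵀ = 2α I + 2β J (the link relation across, the design inside)
  difference-Gram : ∀ a b l → a ≢ b → a ≢ l → b ≢ l → ∀ z w → Kv z w ≡ + 1 →
                    (D a b l · D a b l ᵀ) z w ≡ ikj n m (+ 2 * α) (+ 0) (+ 2 * β) z w
  difference-Gram a b l a≢b a≢l b≢l z w z~w = begin
    (D a b l · D a b l ᵀ) z w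
      ≡⟨ Σ-diff-product v (A a l z) (A b l z) (A a l w) (A b l w) ⟩
    (A a l · A a l ᵀ) z w - Σ v (λ y → A a l z y * A b l w y) - Σ v (λ y → A b l z y * A a l w y) + (A b l · A b l ᵀ) z w
      ≡⟨ cong₂ (λ c d → (A a l · A a l ᵀ) z w - c - d + (A b l · A b l ᵀ) z w)
               (Σ-cong v (λ y → cong (A a l z y *_) (sym (transposed b l b≢l y w))))
               (Σ-cong v (λ y → cong (A b l z y *_) (sym (transposed a l a≢l y w)))) ⟩
    (A a l · A a l ᵀ) z w - (A a l · A l b) z w - (A b l · A l a) z w + (A b l · A b l ᵀ) z w
      ≡⟨ cong₂ _+_ (cong₂ _-_ (cong₂ _-_ (AAᵀ a l a≢l z w) (AA a l b a≢l (≢-sym b≢l) a≢b z w))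
                              (AA b l a b≢l (≢-sym a≢l) (≢-sym a≢b) z w))
                   (AAᵀ b l b≢l z w) ⟩
    α * δ z w + λ₁₂ * Kv z w + + λ₂ * + 1 - (s * A a b z w + + τ * + 1 + u * Kv z w)
      - (s * A b a z w + + τ * + 1 + u * Kv z w) + (α * δ z w + λ₁₂ * Kv z w + + λ₂ * + 1)
      ≡⟨ cong₂ (λ c d → α * δ z w + λ₁₂ * Kv z w + + λ₂ * + 1 - (s * c + + τ * + 1 + u * Kv z w)
                          - (s * d + + τ * + 1 + u * Kv z w) + (α * δ z w + λ₁₂ * Kv z w + + λ₂ * + 1))
               (zero-on-blocks a b a≢b z w z~w) (zero-on-blocks b a (≢-sym a≢b) z w z~w) ⟩
    α * δ z w + λ₁₂ * Kv z w + + λ₂ * + 1 - (s * + 0 + + τ * + 1 + u * Kv z w)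
      - (s * + 0 + + τ * + 1 + u * Kv z w) + (α * δ z w + λ₁₂ * Kv z w + + λ₂ * + 1)
      ≡⟨ cong (λ c → α * δ z w + λ₁₂ * c + + λ₂ * + 1 - (s * + 0 + + τ * + 1 + u * c)
                       - (s * + 0 + + τ * + 1 + u * c) + (α * δ z w + λ₁₂ * c + + λ₂ * + 1)) z~w ⟩
    α * δ z w + λ₁₂ * + 1 + + λ₂ * + 1 - (s * + 0 + + τ * + 1 + u * + 1)
      - (s * + 0 + + τ * + 1 + u * + 1) + (α * δ z w + λ₁₂ * + 1 + + λ₂ * + 1)
      ≡⟨ collect (+ k) (+ λ₁) (+ λ₂) (+ σ) (+ τ) (+ ρ) (δ z w) (Kv z w) ⟩
    ikj n m (+ 2 * α) (+ 0) (+ 2 * β) z w ∎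
    where
    open ≡-Reasoning
    collect : ∀ k l₁ l₂ σ τ ρ d c →
      (k - l₁) * d + (l₁ - l₂) * + 1 + l₂ * + 1 - ((σ - τ) * + 0 + τ * + 1 + (ρ - τ) * + 1)
        - ((σ - τ) * + 0 + τ * + 1 + (ρ - τ) * + 1) + ((k - l₁) * d + (l₁ - l₂) * + 1 + l₂ * + 1)
      ≡ (+ 2 * (k - l₁)) * d + + 0 * c + (+ 2 * (l₁ - ρ)) * + 1
    collect = solve-∀

  -- If E = 0, then K A_{a,l} does not depend on a: the squared entries of row x of
  -- K D_{a,b,l} sum to (K D Dᵀ K)_{xx} = 2nE = 0.
  K·A-independent : E ≡ + 0 → ∀ a b l → a ≢ b → a ≢ l → b ≢ l → ∀ x p → (Kv · A a l) x p ≡ (Kv · A b l) x p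
  K·A-independent E≡0 a b l a≢b a≢l b≢l x p =
    ℤP.i-j≡0⇒i≡j _ _ (trans (sym (K·Δ x p)) (Σ-squares≡0 v (λ q → (Kv · Δ) x q) row-squares p))
    where
    Δ : Mat v
    Δ = D a b l
    K·Δ : ∀ x p → (Kv · Δ) x p ≡ (Kv · A a l) x p - (Kv · A b l) x p
    K·Δ x p = trans (Σ-cong v (λ z → distrib (Kv x z) (A a l z p) (A b l z p))) (Σ-- v _ _)
      where
      distrib : ∀ c a b → c * (a - b) ≡ c * a - c * b
      distrib = solve-∀
    row-squares : Σ v (λ q → (Kv · Δ) x q * (Kv · Δ) x q) ≡ + 0
    row-squares = begin
      Σ v (λ q → (Kv · Δ) x q * (Kv · Δ) x q)
        ≡⟨ Σ-cong v (λ q → cong ((Kv · Δ) x q *_)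
                 (trans (·-transpose Kv Δ q x) (·-congʳ (Δ ᵀ) (λ c d → K-sym n m d c) q x))) ⟩
      (Kv · Δ · (Δ ᵀ · Kv)) x x    ≡⟨ ·-assoc Kv Δ (Δ ᵀ · Kv) x x ⟩
      (Kv · (Δ · (Δ ᵀ · Kv))) x x  ≡⟨ ·-congʳ Kv (λ c d → sym (·-assoc Δ (Δ ᵀ) Kv c d)) x x ⟩
      (Kv · (Δ · Δ ᵀ · Kv)) x x    ≡⟨ sym (·-assoc Kv (Δ · Δ ᵀ) Kv x x) ⟩
      (Kv · (Δ · Δ ᵀ) · Kv) x x
        ≡⟨ K·Z·K-local x (Δ · Δ ᵀ) _ (λ z w z~x w~x →
             difference-Gram a b l a≢b a≢l b≢l z w (K-yes n m z w (trans z~x (sym w~x)))) ⟩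
      (Kv · ikj n m (+ 2 * α) (+ 0) (+ 2 * β) · Kv) x x
        ≡⟨ K·ikj·K (+ 2 * α) (+ 2 * β) x ⟩
      + n * (+ 2 * α) + + n * + n * (+ 2 * β) ≡⟨ twice-nE (+ n) α β ⟩
      + 2 * + n * E                ≡⟨ cong (+ 2 * + n *_) E≡0 ⟩
      + 2 * + n * + 0              ≡⟨ ℤP.*-zeroʳ (+ 2 * + n) ⟩
      + 0                          ∎
      where
      open ≡-Reasoning
      twice-nE : ∀ n α β → n * (+ 2 * α) + n * n * (+ 2 * β) ≡ + 2 * n * (α + n * β)
      twice-nE = solve-∀

  -- for x, y in different groups and E = 0: s (K A_{a,b})_{xy} + nτ = nλ₂, obtained by
  -- computing (K A_{a,l} A_{l,b})_{xy} with the link relation and, after replacing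
  -- K A_{a,l} by K A_{b,l}, with the design equation
  K·A-cross : E ≡ + 0 → ∀ a b l → a ≢ b → a ≢ l → b ≢ l → ∀ x y → Kv x y ≡ + 0 →
              s * (Kv · A a b) x y + + τ * + n ≡ + λ₂ * + n
  K·A-cross E≡0 a b l a≢b a≢l b≢l x y x≁y = begin
    s * (Kv · A a b) x y + + τ * + n  ≡⟨ sym via-link ⟩
    (Kv · A a l · A l b) x y          ≡⟨ ·-congˡ (A l b) (K·A-independent E≡0 a b l a≢b a≢l b≢l) x y ⟩
    (Kv · A b l · A l b) x y          ≡⟨ via-design ⟩
    + λ₂ * + n                        ∎
    where
    open ≡-Reasoning
    K·K≡0 : (Kv · Kv) x y ≡ + n * + 0
    K·K≡0 = trans (K·K n m x y) (cong (+ n *_) x≁y)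
    via-link : (Kv · A a l · A l b) x y ≡ s * (Kv · A a b) x y + + τ * + n
    via-link = begin
      (Kv · A a l · A l b) x y                ≡⟨ ·-assoc Kv (A a l) (A l b) x y ⟩
      (Kv · (A a l · A l b)) x y              ≡⟨ ·-congʳ Kv (AA a l b a≢l (≢-sym b≢l) a≢b) x y ⟩
      (Kv · comb s (A a b) (+ τ) Jv u Kv) x y ≡⟨ ·-combʳ Kv s (A a b) (+ τ) Jv u Kv x y ⟩
      s * (Kv · A a b) x y + + τ * (Kv · Jv) x y + u * (Kv · Kv) x y
        ≡⟨ cong₂ (λ c d → s * (Kv · A a b) x y + + τ * c + u * d) (K·J n m x y) K·K≡0 ⟩
      s * (Kv · A a b) x y + + τ * + n + u * (+ n * + 0) ≡⟨ drop s _ (+ τ) (+ n) u ⟩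
      s * (Kv · A a b) x y + + τ * + n        ∎
      where
      drop : ∀ s a t n u → s * a + t * n + u * (n * + 0) ≡ s * a + t * n
      drop = solve-∀
    via-design : (Kv · A b l · A l b) x y ≡ + λ₂ * + n
    via-design = begin
      (Kv · A b l · A l b) x y          ≡⟨ ·-assoc Kv (A b l) (A l b) x y ⟩
      (Kv · (A b l · A l b)) x y
        ≡⟨ ·-congʳ Kv (λ c d → trans (·-congʳ (A b l) (transposed b l b≢l) c d) (AAᵀ b l b≢l c d)) x y ⟩
      (Kv · ikj n m α λ₁₂ (+ λ₂)) x y   ≡⟨ ·-combʳ Kv α δ λ₁₂ Kv (+ λ₂) Jv x y ⟩
      α * (Kv · δ) x y + λ₁₂ * (Kv · Kv) x y + + λ₂ * (Kv · Jv) x y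
        ≡⟨ cong₂ (λ c d → c + d) (cong₂ (λ c d → α * c + λ₁₂ * d) (trans (·-δʳ Kv x y) x≁y) K·K≡0)
                                 (cong (+ λ₂ *_) (K·J n m x y)) ⟩
      α * + 0 + λ₁₂ * (+ n * + 0) + + λ₂ * + n ≡⟨ drop α λ₁₂ (+ λ₂) (+ n) ⟩
      + λ₂ * + n                        ∎
      where
      drop : ∀ a b c n → a * + 0 + b * (n * + 0) + c * n ≡ c * n
      drop = solve-∀

  -- A_{i,j}K vanishes on the diagonal blocks, because A_{i,j} does
  A·K-on-blocks : ∀ i j → i ≢ j → ∀ x q → Kv x q ≡ + 1 → (A i j · Kv) x q ≡ + 0
  A·K-on-blocks i j i≢j x q x~q = Σ-zero v (λ y → decide (group n y ℕ.≟ group n q)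
    (λ y~q → trans (cong (_* Kv y q) (zero-on-blocks i j i≢j x y
                      (K-yes n m x y (trans (K≡1⇒group n m x q x~q) (sym y~q)))))
                   (ℤP.*-zeroˡ (Kv y q)))
    (λ y≁q → trans (cong (A i j x y *_) (K-no n m y q y≁q)) (ℤP.*-zeroʳ (A i j x y))))

  A·K-transpose : ∀ i j → i ≢ j → ∀ x q → (A i j · Kv) x q ≡ (Kv · A j i) q x
  A·K-transpose i j i≢j x q = Σ-cong v (λ y →
    trans (ℤP.*-comm (A i j x y) (Kv y q)) (cong₂ _*_ (K-sym n m y q) (sym (transposed i j i≢j y x))))

  -- E = 0 and σ ≠ τ: off the diagonal blocks, s (A_{i,j}K)_{xq} = nλ₂ - nτ
  tactical-σ≢τ : E ≡ + 0 → ∀ i j l → i ≢ j → j ≢ l → i ≢ l → σ ≢ τ → Tactical i j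
  tactical-σ≢τ E≡0 i j l i≢j j≢l i≢l σ≢τ x x′ q x~x′ = decide (group n x ℕ.≟ group n q)
    (λ x~q → trans (A·K-on-blocks i j i≢j x q (K-yes n m x q x~q))
                   (sym (A·K-on-blocks i j i≢j x′ q (K-yes n m x′ q (trans (sym x~x′) x~q)))))
    (λ x≁q → trans (A·K-transpose i j i≢j x q)
      (trans (ℤP.*-cancelˡ-≡ s _ _ {{ℤ.≢-nonZero s≢0}}
               (+-cancelʳ (+ τ * + n) _ _
                 (trans (cross q x (K-no n m q x (λ q~x → x≁q (sym q~x))))
                        (sym (cross q x′ (K-no n m q x′ (λ q~x′ → x≁q (trans x~x′ (sym q~x′)))))))))
             (sym (A·K-transpose i j i≢j x′ q))))
    where
    s≢0 : s ≢ + 0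
    s≢0 s≡0 = σ≢τ (ℤP.+-injective (ℤP.i-j≡0⇒i≡j (+ σ) (+ τ) s≡0))
    cross : ∀ x y → Kv x y ≡ + 0 → s * (Kv · A j i) x y + + τ * + n ≡ + λ₂ * + n
    cross = K·A-cross E≡0 j i l (≢-sym i≢j) j≢l i≢l

  p₀ : Fin n → Fin v
  p₀ t = t ↑ˡ (m′ ℕ.* n)

  group-p₀ : ∀ t → group n (p₀ t) ≡ 0
  group-p₀ t = group-↑ˡ n (m′ ℕ.* n) t

  K-p₀ : ∀ t t′ → Kv (p₀ t) (p₀ t′) ≡ + 1
  K-p₀ t t′ = K-yes n m (p₀ t) (p₀ t′) (trans (group-p₀ t) (sym (group-p₀ t′)))

  -- σ = τ together with κ = E = 0 is impossible when λ₁ < k: it forces s = u = 0,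
  -- τ = λ₂ and α = -nλ₁₂, hence A_{i,j}K = n A_{i,j}.  Then two distinct columns of
  -- A_{i,j} over group 0 coincide, and comparing Aᵀ A there with its diagonal gives λ₁ = k.
  module Degenerate (λ₁<k : λ₁ ℕ.< k) (E≡0 : E ≡ + 0) (κ≡0 : κ ≡ + 0) (σ≡τ : σ ≡ τ)
    (i j l : Fin (suc f′)) (i≢j : i ≢ j) (j≢l : j ≢ l) (i≢l : i ≢ l)
    (o : Fin (m′ ℕ.* n)) (t₀ t₁ : Fin n) (t₀≢t₁ : t₀ ≢ t₁) where

    open ≡-Reasoning

    P : Mat v
    P = A i j

    y₀ y₁ : Fin v
    y₀ = p₀ t₀
    y₁ = p₀ t₁

    s≡0 : s ≡ + 0
    s≡0 = trans (cong (λ t → + t - + τ) σ≡τ) (ℤP.+-inverseʳ (+ τ))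

    τ≡λ₂ : + τ ≡ + λ₂
    τ≡λ₂ = ℤP.*-cancelʳ-≡ (+ τ) (+ λ₂) (+ n)
      (trans (sym (trans (cong (λ c → c * (Kv · A i j) y₀ (n ↑ʳ o) + + τ * + n) s≡0) (ℤP.+-identityˡ (+ τ * + n))))
             (K·A-cross E≡0 i j l i≢j i≢l j≢l y₀ (n ↑ʳ o) (K-no n m y₀ (n ↑ʳ o) different-groups)))
      where
      different-groups : group n y₀ ≢ group n (n ↑ʳ o)
      different-groups e = ℕP.0≢1+n (trans (sym (group-p₀ t₀)) (trans e (group-↑ʳ n o)))

    α+λ₁₂n≡0 : α + λ₁₂ * + n ≡ + 0
    α+λ₁₂n≡0 = trans (restore α (λ₁₂ * + n) s) (cong₂ (λ c d → c + d * d) κ≡0 s≡0)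
      where
      restore : ∀ a b s → a + b ≡ (a + b - s * s) + s * s
      restore = solve-∀

    ρ≡λ₂ : + ρ ≡ + λ₂
    ρ≡λ₂ = ℤP.i-j≡0⇒i≡j (+ ρ) (+ λ₂) (ℤP.*-cancelˡ-≡ (+ n) _ (+ 0)
      (trans (difference (+ k) (+ λ₁) (+ λ₂) (+ ρ) (+ n))
             (trans (cong₂ _-_ α+λ₁₂n≡0 E≡0) (sym (ℤP.*-zeroʳ (+ n))))))
      where
      difference : ∀ k l₁ l₂ r n → n * (r - l₂) ≡ ((k - l₁) + (l₁ - l₂) * n) - ((k - l₁) + n * (l₁ - r))
      difference = solve-∀

    u≡0 : u ≡ + 0
    u≡0 = trans (cong₂ _-_ ρ≡λ₂ τ≡λ₂) (ℤP.+-inverseʳ (+ λ₂))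

    λ₁₂≢0 : λ₁₂ ≢ + 0
    λ₁₂≢0 λ₁₂≡0 = ℕP.<-irrefl (ℤP.+-injective (sym (ℤP.i-j≡0⇒i≡j (+ k) (+ λ₁)
      (trans (sym (ℤP.+-identityʳ α)) (trans (cong (λ c → α + c * + n) (sym λ₁₂≡0)) α+λ₁₂n≡0))))) λ₁<k
    -- the triple product with s = u = 0 and τ = λ₂
    αP+λ₁₂PK≡0 : ∀ x y → α * P x y + λ₁₂ * (P · Kv) x y ≡ + 0
    αP+λ₁₂PK≡0 x y = begin
      α * P x y + λ₁₂ * (P · Kv) x y
        ≡⟨ restore (α * P x y + λ₁₂ * (P · Kv) x y) (+ λ₂ * + k) ⟩
      comb α P λ₁₂ (P · Kv) (+ λ₂ * + k) Jv x y - (+ λ₂ * + k) * + 1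
        ≡⟨ cong (_- (+ λ₂ * + k) * + 1) (triple-product i j l i≢j j≢l i≢l x y) ⟩
      comb s (comb s P (+ τ) Jv u Kv) (+ τ * + k) Jv u (Kv · A l j) x y - (+ λ₂ * + k) * + 1
        ≡⟨ vanish (comb s P (+ τ) Jv u Kv x y) ((Kv · A l j) x y) s≡0 u≡0 τ≡λ₂ ⟩
      + 0 ∎
      where
      restore : ∀ a c → a ≡ a + c * + 1 - c * + 1
      restore = solve-∀
      vanish : ∀ {s u t} X Y → s ≡ + 0 → u ≡ + 0 → t ≡ + λ₂ →
               s * X + (t * + k) * + 1 + u * Y - (+ λ₂ * + k) * + 1 ≡ + 0
      vanish X Y refl refl refl = cancel X Y (+ λ₂ * + k)
        where
        cancel : ∀ X Y c → + 0 * X + c * + 1 + + 0 * Y - c * + 1 ≡ + 0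
        cancel = solve-∀

    PK≡nP : ∀ x y → (P · Kv) x y ≡ + n * P x y
    PK≡nP x y = ℤP.i-j≡0⇒i≡j _ _ (ℤP.*-cancelˡ-≡ λ₁₂ _ (+ 0) {{ℤ.≢-nonZero λ₁₂≢0}}
      (trans (regroup α λ₁₂ (+ n) (P x y) ((P · Kv) x y))
             (trans (cong₂ (λ c d → c - P x y * d) (αP+λ₁₂PK≡0 x y) α+λ₁₂n≡0) (vanish (P x y) λ₁₂))))
      where
      regroup : ∀ a b n p q → b * (q - n * p) ≡ (a * p + b * q) - p * (a + b * n)
      regroup = solve-∀
      vanish : ∀ p c → + 0 - p * + 0 ≡ c * + 0
      vanish = solve-∀

    columns-coincide : ∀ x → P x y₁ ≡ P x y₀
    columns-coincide x = ℤP.*-cancelˡ-≡ (+ n) _ _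
      (trans (sym (PK≡nP x y₁)) (trans (Σ-cong v (λ z → cong (P x z *_) same-K)) (PK≡nP x y₀)))
      where
      same-K : ∀ {z} → Kv z y₁ ≡ Kv z y₀
      same-K {z} = trans (K-sym n m z y₁)
        (trans (K-group n m y₀ y₁ z (trans (group-p₀ t₀) (sym (group-p₀ t₁)))) (K-sym n m y₀ z))

    λ₁≡k : + λ₁ ≡ + k
    λ₁≡k = begin
      + λ₁                              ≡⟨ off-diagonal (+ k) (+ λ₁) (+ λ₂) ⟩
      α * + 0 + λ₁₂ * + 1 + + λ₂ * + 1  ≡⟨ sym (cong₂ (λ c d → α * c + λ₁₂ * d + + λ₂ * + 1)
                                                      (δ-ne (λ e → t₀≢t₁ (FP.↑ˡ-injective (m′ ℕ.* n) t₀ t₁ e)))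
                                                      (K-p₀ t₀ t₁)) ⟩
      ikj n m α λ₁₂ (+ λ₂) y₀ y₁        ≡⟨ sym (AᵀA i j i≢j y₀ y₁) ⟩
      Σ v (λ x → P x y₀ * P x y₁)       ≡⟨ Σ-cong v (λ x → cong (P x y₀ *_) (columns-coincide x)) ⟩
      Σ v (λ x → P x y₀ * P x y₀)       ≡⟨ AᵀA i j i≢j y₀ y₀ ⟩
      ikj n m α λ₁₂ (+ λ₂) y₀ y₀        ≡⟨ ikj-diag n m α λ₁₂ (+ λ₂) y₀ ⟩
      α + λ₁₂ + + λ₂                    ≡⟨ coefficient-sum ⟩
      + k                               ∎
      where
      off-diagonal : ∀ k l₁ l₂ → l₁ ≡ (k - l₁) * + 0 + (l₁ - l₂) * + 1 + l₂ * + 1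
      off-diagonal = solve-∀

    impossible : ⊥
    impossible = ℕP.<-irrefl (ℤP.+-injective λ₁≡k) λ₁<k

  tactical : λ₁ ℕ.< k → E ≡ + 0 → ∀ i j l → i ≢ j → j ≢ l → i ≢ l →
             Fin (m′ ℕ.* n) → (t₀ t₁ : Fin n) → t₀ ≢ t₁ → Tactical i j
  tactical λ₁<k E≡0 i j l i≢j j≢l i≢l o t₀ t₁ t₀≢t₁ with κ ℤ.≟ + 0 | σ ℕ.≟ τ
  ... | no κ≢0  | _       = tactical-κ≢0 i j l i≢j j≢l i≢l κ≢0
  ... | yes _   | no σ≢τ  = tactical-σ≢τ E≡0 i j l i≢j j≢l i≢l σ≢τ
  ... | yes κ≡0 | yes σ≡τ = ⊥-elim (Degenerate.impossible λ₁<k E≡0 κ≡0 σ≡τ i j l i≢j j≢l i≢l o t₀ t₁ t₀≢t₁)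

  -- The matrix X.  Its rows are indexed by Fin N, N = f′n; row a, lying in group
  -- ⌊a/n⌋ = g at position t = a mod n, is row p₀ t of A_{g+1,0}.

  N : ℕ
  N = f′ ℕ.* n

  member : Fin N → Fin f′
  member a = F.fromℕ< (group< n f′ a)

  position : Fin N → Fin n
  position a = F.fromℕ< (m%n<n (toℕ a) n)

  X : Matrix N v
  X a p = A (F.suc (member a)) F.zero (p₀ (position a)) p

  suc≢0 : ∀ (i : Fin f′) → F.suc i ≢ F.zero
  suc≢0 i ()

  member-≡ : ∀ a b → group n a ≡ group n b → member a ≡ member b
  member-≡ a b e = FP.toℕ-injective
    (trans (FP.toℕ-fromℕ< (group< n f′ a)) (trans e (sym (FP.toℕ-fromℕ< (group< n f′ b)))))

  member-≢ : ∀ a b → group n a ≢ group n b → F.suc (member a) ≢ F.suc (member b)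
  member-≢ a b ne e = ne (trans (sym (FP.toℕ-fromℕ< (group< n f′ a)))
    (trans (cong toℕ (FP.suc-injective e)) (FP.toℕ-fromℕ< (group< n f′ b))))

  δ-rows : ∀ a b → group n a ≡ group n b → δ (p₀ (position a)) (p₀ (position b)) ≡ δ a b
  δ-rows a b a~b = decide (toℕ a % n ℕ.≟ toℕ b % n)
    (λ e → trans (cong (λ t → δ (p₀ (position a)) (p₀ t)) (sym (same-position e)))
                 (trans (δ-refl (p₀ (position a))) (trans (sym (δ-refl a)) (cong (δ a) (same-row e)))))
    (λ ne → trans (δ-ne (λ e → ne (different-position e))) (sym (δ-ne (λ e → ne (cong (λ z → toℕ z % n) e)))))
    where
    same-row : toℕ a % n ≡ toℕ b % n → a ≡ b
    same-row e = FP.toℕ-injective (trans (m≡m%n+[m/n]*n (toℕ a) n)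
      (trans (cong₂ (λ r g → r ℕ.+ g ℕ.* n) e a~b) (sym (m≡m%n+[m/n]*n (toℕ b) n))))
    same-position : toℕ a % n ≡ toℕ b % n → position a ≡ position b
    same-position e = FP.toℕ-injective
      (trans (FP.toℕ-fromℕ< (m%n<n (toℕ a) n)) (trans e (sym (FP.toℕ-fromℕ< (m%n<n (toℕ b) n)))))
    different-position : p₀ (position a) ≡ p₀ (position b) → toℕ a % n ≡ toℕ b % n
    different-position e = trans (sym (FP.toℕ-fromℕ< (m%n<n (toℕ a) n)))
      (trans (cong toℕ (FP.↑ˡ-injective (m′ ℕ.* n) (position a) (position b) e)) (FP.toℕ-fromℕ< (m%n<n (toℕ b) n)))

  X-zero : ∀ a t → X a (p₀ t) ≡ + 0
  X-zero a t = zero-on-blocks (F.suc (member a)) F.zero (suc≢0 (member a)) (p₀ (position a)) (p₀ t)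
                              (K-p₀ (position a) t)

  -- The Gram matrix: X Xᵀ = α I + β K + ρ J, by the design equation within a group and
  -- the link relation A_{g+1,0} A_{0,h+1} = s A_{g+1,h+1} + τ J + u K across groups.
  Gram : ∀ a b → (X · X ᵀ) a b ≡ ikj n f′ α β (+ ρ) a b
  Gram a b = decide (group n a ℕ.≟ group n b) same-group different-groups
    where
    open ≡-Reasoning
    i : Fin (suc f′)
    i = F.suc (member a)
    ta tb : Fin v
    ta = p₀ (position a)
    tb = p₀ (position b)
    same-group : group n a ≡ group n b → (X · X ᵀ) a b ≡ ikj n f′ α β (+ ρ) a b
    same-group a~b = begin
      (X · X ᵀ) a b
        ≡⟨ Σ-cong v (λ p → cong (λ i′ → X a p * A (F.suc i′) F.zero tb p) (sym (member-≡ a b a~b))) ⟩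
      (A i F.zero · A i F.zero ᵀ) ta tb                ≡⟨ AAᵀ i F.zero (suc≢0 (member a)) ta tb ⟩
      α * δ ta tb + λ₁₂ * Kv ta tb + + λ₂ * + 1
        ≡⟨ cong₂ (λ c d → α * c + λ₁₂ * d + + λ₂ * + 1) (δ-rows a b a~b) (K-p₀ (position a) (position b)) ⟩
      α * δ a b + λ₁₂ * + 1 + + λ₂ * + 1               ≡⟨ regroup (+ k) (+ λ₁) (+ λ₂) (+ ρ) (δ a b) ⟩
      α * δ a b + β * + 1 + + ρ * + 1                  ≡⟨ cong (λ c → α * δ a b + β * c + + ρ * + 1) (sym (K-yes n f′ a b a~b)) ⟩
      ikj n f′ α β (+ ρ) a b                           ∎
      where
      regroup : ∀ k l₁ l₂ r d → (k - l₁) * d + (l₁ - l₂) * + 1 + l₂ * + 1 ≡ (k - l₁) * d + (l₁ - r) * + 1 + r * + 1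
      regroup = solve-∀
    different-groups : group n a ≢ group n b → (X · X ᵀ) a b ≡ ikj n f′ α β (+ ρ) a b
    different-groups a≁b = begin
      (X · X ᵀ) a b
        ≡⟨ Σ-cong v (λ p → cong (X a p *_) (sym (transposed j F.zero (suc≢0 (member b)) p tb))) ⟩
      (A i F.zero · A F.zero j) ta tb
        ≡⟨ AA i F.zero j (suc≢0 (member a)) (≢-sym (suc≢0 (member b))) i≢j ta tb ⟩
      s * A i j ta tb + + τ * + 1 + u * Kv ta tb
        ≡⟨ cong₂ (λ c d → s * c + + τ * + 1 + u * d)
                 (zero-on-blocks i j i≢j ta tb (K-p₀ (position a) (position b))) (K-p₀ (position a) (position b)) ⟩
      s * + 0 + + τ * + 1 + u * + 1                    ≡⟨ regroup (+ k) (+ λ₁) (+ σ) (+ τ) (+ ρ) ⟩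
      α * + 0 + β * + 0 + + ρ * + 1
        ≡⟨ sym (cong₂ (λ c d → α * c + β * d + + ρ * + 1) (δ-ne (λ e → a≁b (cong (group n) e))) (K-no n f′ a b a≁b)) ⟩
      ikj n f′ α β (+ ρ) a b                           ∎
      where
      j : Fin (suc f′)
      j = F.suc (member b)
      i≢j : i ≢ j
      i≢j = member-≢ a b a≁b
      regroup : ∀ k l₁ σ τ ρ → (σ - τ) * + 0 + τ * + 1 + (ρ - τ) * + 1 ≡ (k - l₁) * + 0 + (l₁ - ρ) * + 0 + ρ * + 1
      regroup = solve-∀

  module SandwichIKJ (W C : Mat N) (W-sym : ∀ a b → W a b ≡ W b a) (c e : ℤ)
    (GW : ∀ a b → (ikj n f′ α β (+ ρ) · W) a b ≡ c * C a b)
    (WC : ∀ a b → (W · C) a b ≡ e * W a b) where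

    open Sandwich X W W-sym public

    G·W : ∀ a b → (G · W) a b ≡ c * C a b
    G·W a b = trans (·-congˡ W Gram a b) (GW a b)

    M² : ∀ p q → (M · M) p q ≡ (c * e) * M p q
    M² = M-idem (c * e) WGW
      where
      WGW : ∀ a b → (W · G · W) a b ≡ (c * e) * W a b
      WGW a b = begin
        (W · G · W) a b                   ≡⟨ ·-assoc W G W a b ⟩
        (W · (G · W)) a b                 ≡⟨ ·-congʳ W G·W a b ⟩
        (W · (λ u w → c * C u w)) a b     ≡⟨ ·-scaleʳ W c C a b ⟩
        c * (W · C) a b                   ≡⟨ cong (c *_) (WC a b) ⟩
        c * (e * W a b)                   ≡⟨ sym (ℤP.*-assoc c e (W a b)) ⟩
        (c * e) * W a b                   ∎
        where open ≡-Reasoning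

    trace-M : tr M ≡ c * tr C
    trace-M = trans M-trace (trans (tr-cyclic W G) (trans (Σ-cong N (λ a → G·W a a)) (Σ-*ˡ N c (λ a → C a a))))

  -- Case E ≠ 0.  W = nNE I - nNβ K - nα J satisfies G W = αEn (N I - J) and
  -- W (N I - J) = N W, so M = Xᵀ W X has M² = (αEnN) M and tr M = αEnN (N - 1);
  -- the rank bound gives N - 1 ≤ m′n.
  module BoundE≢0 (E≢0 : E ≢ + 0) (α≢0 : α ≢ + 0) where

    nN αEn : ℤ
    nN = + n * + N
    αEn = α * E * + n

    W C : Mat N
    W = ikj n f′ (nN * E) (- (nN * β)) (- (+ n * α))
    C = ikj n f′ (+ N) (+ 0) (- + 1)

    GW : ∀ a b → (ikj n f′ α β (+ ρ) · W) a b ≡ αEn * C a b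
    GW a b = trans (ikj-product-≡ n f′ α β (+ ρ) (nN * E) (- (nN * β)) (- (+ n * α))
                                  (αEn * + N) (αEn * + 0) (αEn * - + 1)
                                  (I-coefficient α β (+ n) (+ N)) (K-coefficient α β (+ n) (+ N))
                                  (J-coefficient α β (+ ρ) (+ n) (+ N)) a b)
                   (ikj-scale n f′ αEn (+ N) (+ 0) (- + 1) a b)
      where
      I-coefficient : ∀ a b n N → a * (n * N * (a + n * b)) ≡ a * (a + n * b) * n * N
      I-coefficient = solve-∀
      K-coefficient : ∀ a b n N → a * - (n * N * b) + b * (n * N * (a + n * b)) + n * b * - (n * N * b)
                                  ≡ a * (a + n * b) * n * + 0
      K-coefficient = solve-∀
      J-coefficient : ∀ a b r n N → a * - (n * a) + r * (n * N * (a + n * b)) + n * b * - (n * a)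
                                    + n * r * - (n * N * b) + N * r * - (n * a) ≡ a * (a + n * b) * n * - + 1
      J-coefficient = solve-∀

    WC : ∀ a b → (W · C) a b ≡ + N * W a b
    WC a b = trans (ikj-product-≡ n f′ (nN * E) (- (nN * β)) (- (+ n * α)) (+ N) (+ 0) (- + 1)
                                  (+ N * (nN * E)) (+ N * - (nN * β)) (+ N * - (+ n * α))
                                  (I-coefficient (+ n) (+ N) E) (K-coefficient (+ n) (+ N) E β)
                                  (J-coefficient α β (+ n) (+ N)) a b)
                   (ikj-scale n f′ (+ N) (nN * E) (- (nN * β)) (- (+ n * α)) a b)
      where
      I-coefficient : ∀ n N e → n * N * e * N ≡ N * (n * N * e)
      I-coefficient = solve-∀
      K-coefficient : ∀ n N e b → n * N * e * + 0 + - (n * N * b) * N + n * - (n * N * b) * + 0 ≡ N * - (n * N * b)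
      K-coefficient = solve-∀
      J-coefficient : ∀ a b n N → n * N * (a + n * b) * - + 1 + - (n * a) * N + n * - (n * N * b) * - + 1
                                  + n * - (n * a) * + 0 + N * - (n * a) * - + 1 ≡ N * - (n * a)
      J-coefficient = solve-∀

    open SandwichIKJ W C (ikj-sym n f′ (nN * E) (- (nN * β)) (- (+ n * α))) αEn (+ N) GW WC

    trace-M′ : tr M ≡ (αEn * + N) * (+ N - + 1)
    trace-M′ = trans trace-M (trans (cong (αEn *_) (ikj-trace n f′ (+ N) (+ 0) (- + 1))) (regroup αEn (+ N)))
      where
      regroup : ∀ c N → c * (N * (N + + 0 + - + 1)) ≡ (c * N) * (N - + 1)
      regroup = solve-∀

    bound : + 0 < + N - + 1 → + N - + 1 ≤ + (m′ ℕ.* n)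
    bound N>1 =
      rank-bound n (m′ ℕ.* n) M (αEn * + N) (+ N - + 1) M-sym M² (λ t → M-zero (p₀ t) (λ a → X-zero a t))
                 (*-≢0 (*-≢0 (*-≢0 α≢0 E≢0) n≢0) N≢0) trace-M′ N>1
      where
      N≢0 : + N ≢ + 0
      N≢0 N≡0 = 0≮-1 (subst (λ c → + 0 < c - + 1) N≡0 N>1)
        where
        0≮-1 : ¬ (+ 0 < + 0 - + 1)
        0≮-1 ()

  -- W₂ = nI - K satisfies G W₂ = α W₂ and
  -- W₂² = n W₂, so M = Xᵀ W₂ X has M² = αn M and tr M = αN(n - 1).  Tacticality makes the
  -- rows of X Π constant on groups (Π = K without group 0), so W₂ X Π = 0 and M Π = Π M = 0.
  -- Hence M + αΠ squares to αn times itself and has trace αn (f′(n - 1) + m′); the rank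
  -- bound gives f′(n - 1) + m′ ≤ m′n.
  module BoundE≡0 (α≢0 : α ≢ + 0) (t₀ : Fin n) (tactical-rows : ∀ i → Tactical (F.suc i) F.zero) where

    open ≡-Reasoning

    W₂ : Mat N
    W₂ = ikj n f′ (+ n) (- + 1) (+ 0)

    GW₂ : ∀ a b → (ikj n f′ α β (+ ρ) · W₂) a b ≡ α * W₂ a b
    GW₂ a b = trans (ikj-product-≡ n f′ α β (+ ρ) (+ n) (- + 1) (+ 0) (α * + n) (α * - + 1) (α * + 0)
                                   refl (K-coefficient α β (+ n)) (J-coefficient α β (+ ρ) (+ n) (+ N)) a b)
                    (ikj-scale n f′ α (+ n) (- + 1) (+ 0) a b)
      where
      K-coefficient : ∀ a b n → a * - + 1 + b * n + n * b * - + 1 ≡ a * - + 1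
      K-coefficient = solve-∀
      J-coefficient : ∀ a b r n N → a * + 0 + r * n + n * b * + 0 + n * r * - + 1 + N * r * + 0 ≡ a * + 0
      J-coefficient = solve-∀

    W₂² : ∀ a b → (W₂ · W₂) a b ≡ + n * W₂ a b
    W₂² a b = trans (ikj-product-≡ n f′ (+ n) (- + 1) (+ 0) (+ n) (- + 1) (+ 0) (+ n * + n) (+ n * - + 1) (+ n * + 0)
                                   refl (K-coefficient (+ n)) (J-coefficient (+ n) (+ N)) a b)
                    (ikj-scale n f′ (+ n) (+ n) (- + 1) (+ 0) a b)
      where
      K-coefficient : ∀ n → n * - + 1 + - + 1 * n + n * - + 1 * - + 1 ≡ n * - + 1
      K-coefficient = solve-∀
      J-coefficient : ∀ n N → n * + 0 + + 0 * n + n * - + 1 * + 0 + n * + 0 * - + 1 + N * + 0 * + 0 ≡ n * + 0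
      J-coefficient = solve-∀

    open SandwichIKJ W₂ W₂ (ikj-sym n f′ (+ n) (- + 1) (+ 0)) α (+ n) GW₂ W₂²

    z₀ : Fin v
    z₀ = p₀ t₀

    Π αΠ : Mat v
    Π = K-without n m z₀
    αΠ p q = α * Π p q

    Z : Matrix N v
    Z a q = (A (F.suc (member a)) F.zero · Kv) (p₀ (position a)) q

    XΠ≡Z : ∀ a q → (X · Π) a q ≡ Z a q
    XΠ≡Z a q = begin
      Σ v (λ r → X a r * (Kv r q - Kv z₀ r * Kv z₀ q))
        ≡⟨ Σ-cong v (λ r → trans (distrib (X a r) (Kv r q) (Kv z₀ r) (Kv z₀ q))
                                 (cong (λ c → X a r * Kv r q - X a r * c * Kv z₀ q) (K-sym n m z₀ r))) ⟩
      Σ v (λ r → X a r * Kv r q - X a r * Kv r z₀ * Kv z₀ q)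
        ≡⟨ Σ-- v _ _ ⟩
      Z a q - Σ v (λ r → X a r * Kv r z₀ * Kv z₀ q)
        ≡⟨ cong (_-_ (Z a q)) (trans (Σ-*ʳ v (Kv z₀ q) (λ r → X a r * Kv r z₀))
             (cong (_* Kv z₀ q) (A·K-on-blocks (F.suc (member a)) F.zero (suc≢0 (member a))
                                               (p₀ (position a)) z₀ (K-p₀ (position a) t₀)))) ⟩
      Z a q - + 0 * Kv z₀ q ≡⟨ ℤP.+-identityʳ (Z a q) ⟩
      Z a q ∎
      where
      distrib : ∀ x a b c → x * (a - b * c) ≡ x * a - x * b * c
      distrib = solve-∀

    Z-group : ∀ a b → group n a ≡ group n b → ∀ q → Z b q ≡ Z a q
    Z-group a b a~b q =
      trans (cong (λ i → (A (F.suc i) F.zero · Kv) (p₀ (position b)) q) (sym (member-≡ a b a~b)))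
            (tactical-rows (member a) (p₀ (position b)) (p₀ (position a)) q
                           (trans (group-p₀ (position b)) (sym (group-p₀ (position a)))))

    W₂Z≡0 : ∀ a q → (W₂ · Z) a q ≡ + 0
    W₂Z≡0 a q = begin
      (W₂ · Z) a q
        ≡⟨ ·-combˡ (+ n) δ (- + 1) (K f′ n) (+ 0) (J N) Z a q ⟩
      + n * (δ · Z) a q + - + 1 * (K f′ n · Z) a q + + 0 * (J N · Z) a q
        ≡⟨ cong₂ (λ c d → + n * c + - + 1 * d + + 0 * (J N · Z) a q) (·-δˡ Z a q) K·Z ⟩
      + n * Z a q + - + 1 * (+ n * Z a q) + + 0 * (J N · Z) a q
        ≡⟨ cancel (+ n) (Z a q) ((J N · Z) a q) ⟩
      + 0 ∎
      where
      K·Z : (K f′ n · Z) a q ≡ + n * Z a q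
      K·Z = trans (Σ-cong N (λ b → decide (group n a ℕ.≟ group n b)
                    (λ a~b → cong (K f′ n a b *_) (Z-group a b a~b q))
                    (λ a≁b → trans (cong (_* Z b q) (K-no n f′ a b a≁b)) (sym (cong (_* Z a q) (K-no n f′ a b a≁b))))))
                  (trans (Σ-*ʳ N (Z a q) (K f′ n a)) (cong (_* Z a q) (K-row-sum n f′ a)))
      cancel : ∀ n z w → n * z + - + 1 * (n * z) + + 0 * w ≡ + 0
      cancel = solve-∀

    M·Π≡0 : ∀ p q → (M · Π) p q ≡ + 0
    M·Π≡0 p q = trans (·-assoc (X ᵀ) (W₂ · X) Π p q)
      (trans (·-congʳ (X ᵀ) (λ a w → trans (·-assoc W₂ X Π a w) (trans (·-congʳ W₂ XΠ≡Z a w) (W₂Z≡0 a w))) p q)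
             (Σ-zero N (λ a → ℤP.*-zeroʳ (X a p))))

    Π·M≡0 : ∀ p q → (Π · M) p q ≡ + 0
    Π·M≡0 p q = trans (Σ-cong v (λ r → trans (cong₂ _*_ (K-without-sym n m z₀ p r) (M-sym r q)) (ℤP.*-comm (Π r p) (M q r))))
                      (M·Π≡0 q p)

    M⊕αΠ² : ∀ p q → ((M ⊕ αΠ) · (M ⊕ αΠ)) p q ≡ (α * + n) * (M ⊕ αΠ) p q
    M⊕αΠ² = orthogonal-sum M αΠ (α * + n) M² αΠ² M·αΠ αΠ·M
      where
      αΠ² : ∀ p q → (αΠ · αΠ) p q ≡ (α * + n) * αΠ p q
      αΠ² p q = trans (·-scaleˡ α Π αΠ p q) (trans (cong (α *_) (·-scaleʳ Π α Π p q))
                  (trans (cong (λ c → α * (α * c)) (K-without-square n m z₀ p q)) (regroup α (+ n) (Π p q))))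
        where
        regroup : ∀ a n π → a * (a * (n * π)) ≡ (a * n) * (a * π)
        regroup = solve-∀
      M·αΠ : ∀ p q → (M · αΠ) p q ≡ + 0
      M·αΠ p q = trans (·-scaleʳ M α Π p q) (trans (cong (α *_) (M·Π≡0 p q)) (ℤP.*-zeroʳ α))
      αΠ·M : ∀ p q → (αΠ · M) p q ≡ + 0
      αΠ·M p q = trans (·-scaleˡ α Π M p q) (trans (cong (α *_) (Π·M≡0 p q)) (ℤP.*-zeroʳ α))

    M⊕αΠ-sym : ∀ p q → (M ⊕ αΠ) p q ≡ (M ⊕ αΠ) q p
    M⊕αΠ-sym p q = cong₂ (λ c d → c + α * d) (M-sym p q) (K-without-sym n m z₀ p q)

    M⊕αΠ-zero : ∀ t → (M ⊕ αΠ) (p₀ t) (p₀ t) ≡ + 0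
    M⊕αΠ-zero t = trans (cong₂ (λ c d → c + α * d) (M-zero (p₀ t) (λ a → X-zero a t))
                                                  (K-without-block n m z₀ (p₀ t) (trans (group-p₀ t) (sym (group-p₀ t₀)))))
                       (trans (ℤP.+-identityˡ (α * + 0)) (ℤP.*-zeroʳ α))

    trace-M⊕αΠ : tr (M ⊕ αΠ) ≡ (α * + n) * (+ f′ * (+ n - + 1) + + m′)
    trace-M⊕αΠ = begin
      tr (M ⊕ αΠ)                      ≡⟨ Σ-+ v _ _ ⟩
      tr M + Σ v (λ p → α * Π p p)     ≡⟨ cong₂ _+_ (trans trace-M (cong (α *_) (ikj-trace n f′ (+ n) (- + 1) (+ 0))))
                                                   (trans (Σ-*ˡ v α (λ p → Π p p)) (cong (α *_) (K-without-trace n m z₀))) ⟩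
      α * (+ N * (+ n + - + 1 + + 0)) + α * (+ (n ℕ.+ m′ ℕ.* n) - + n)
        ≡⟨ cong₂ (λ c d → α * (c * (+ n + - + 1 + + 0)) + α * (d - + n))
                 (ℤP.pos-* f′ n) (trans (ℤP.pos-+ n (m′ ℕ.* n)) (cong (_+_ (+ n)) (ℤP.pos-* m′ n))) ⟩
      α * (+ f′ * + n * (+ n + - + 1 + + 0)) + α * (+ n + + m′ * + n - + n)
        ≡⟨ collect α (+ f′) (+ m′) (+ n) ⟩
      (α * + n) * (+ f′ * (+ n - + 1) + + m′) ∎
      where
      collect : ∀ a f m n → a * (f * n * (n + - + 1 + + 0)) + a * (n + m * n - n) ≡ (a * n) * (f * (n - + 1) + m)
      collect = solve-∀

    bound : + 0 < + f′ * (+ n - + 1) + + m′ → + f′ * (+ n - + 1) + + m′ ≤ + (m′ ℕ.* n)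
    bound = rank-bound n (m′ ℕ.* n) (M ⊕ αΠ) (α * + n) _ M⊕αΠ-sym M⊕αΠ² M⊕αΠ-zero (*-≢0 α≢0 n≢0) trace-M⊕αΠ

  f′≤m′ : λ₁ ℕ.< k → 1 ℕ.< n → 1 ℕ.≤ m′ → 1 ℕ.≤ f′ →
          (third : Fin f′ → Fin (suc f′)) → (∀ i → F.suc i ≢ third i) → (∀ i → F.zero ≢ third i) →
          f′ ℕ.≤ m′
  f′≤m′ λ₁<k 1<n 1≤m′ 1≤f′ third suc≢third zero≢third = decide (E ℤ.≟ + 0)
    (λ E≡0 → f≤m-from-E≡0 f′ m′ n 1<n (BoundE≡0.bound α≢0 t₀ (tactical-rows E≡0) T>0))
    (λ E≢0 → f≤m-from-E≢0 f′ m′ n 1<n (BoundE≢0.bound E≢0 α≢0 N>1))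
    where
    α≢0 : α ≢ + 0
    α≢0 α≡0 = ℕP.<-irrefl (ℤP.+-injective (sym (ℤP.i-j≡0⇒i≡j (+ k) (+ λ₁) α≡0))) λ₁<k
    0<n : 0 ℕ.< n
    0<n = ℕP.<-trans (s≤s z≤n) 1<n
    t₀ t₁ : Fin n
    t₀ = F.fromℕ< 0<n
    t₁ = F.fromℕ< 1<n
    t₀≢t₁ : t₀ ≢ t₁
    t₀≢t₁ e = ℕP.0≢1+n (trans (sym (FP.toℕ-fromℕ< 0<n)) (trans (cong toℕ e) (FP.toℕ-fromℕ< 1<n)))
    o : Fin (m′ ℕ.* n)
    o = F.fromℕ< (ℕP.*-mono-≤ 1≤m′ (ℕP.<⇒≤ 1<n))
    tactical-rows : E ≡ + 0 → ∀ i → Tactical (F.suc i) F.zero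
    tactical-rows E≡0 i = tactical λ₁<k E≡0 (F.suc i) F.zero (third i) (suc≢0 i) (zero≢third i)
                                   (suc≢third i) o t₀ t₁ t₀≢t₁
    N>1 : + 0 < + N - + 1
    N>1 = 0<n-1 (ℕP.*-mono-≤ 1≤f′ 1<n)
    T>0 : + 0 < + f′ * (+ n - + 1) + + m′
    T>0 = ℤP.+-mono-≤-< (subst (_≤ + f′ * (+ n - + 1)) (ℤP.*-zeroʳ (+ f′))
                              (ℤP.*-monoˡ-≤-nonNeg (+ f′) (ℤP.<⇒≤ (0<n-1 1<n))))
                        (+<+ 1≤m′)

-- Corollary 5.2.  Write f = f′ + 1 with f′ ≥ 2 and m = m′ + 1 with m′ ≥ 1, and apply the
-- bound f′ ≤ m′.
corollary5p2 : (f m n k λ₁ λ₂ σ τ ρ : ℕ) .{{_ : NonZero n}} →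
    1 ℕ.< m → 1 ℕ.< n → 3 ℕ.≤ f →
    (A : Fin f → Fin f → Mat (m ℕ.* n)) →
    IsLinkedTypeII f m n k λ₁ λ₂ σ τ ρ A →
    λ₁ ℕ.< k → k ℕ.< (m ∸ 1) ℕ.* n →
    (∀ i j → i ≢ j → ∀ x y → A j i x y ≡ A i j y x) →
    f ℕ.≤ m
corollary5p2 (suc (suc (suc g))) (suc m′) n k λ₁ λ₂ σ τ ρ (s≤s 1≤m′) 1<n _ A (_ , design , blocks01 , linked)
             λ₁<k _ transposed =
  s≤s (LinkedSystem.f′≤m′ (suc (suc g)) m′ n k λ₁ λ₂ σ τ ρ A design blocks01 linked transposed
                          λ₁<k 1<n 1≤m′ (s≤s z≤n) third suc≢third zero≢third)
  where
  third : Fin (suc (suc g)) → Fin (suc (suc (suc g)))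
  third F.zero    = F.suc (F.suc F.zero)
  third (F.suc _) = F.suc F.zero
  suc≢third : ∀ i → F.suc i ≢ third i
  suc≢third F.zero    ()
  suc≢third (F.suc i) e with FP.suc-injective e
  ... | ()
  zero≢third : ∀ i → F.zero ≢ third i
  zero≢third F.zero    ()
  zero≢third (F.suc _) ()
corollary5p2 _ 0 _ _ _ _ _ _ _ () _ _ _ _ _ _ _
corollary5p2 0 _ _ _ _ _ _ _ _ _ _ () _ _ _ _ _
corollary5p2 1 _ _ _ _ _ _ _ _ _ _ (s≤s ()) _ _ _ _ _
corollary5p2 2 _ _ _ _ _ _ _ _ _ _ (s≤s (s≤s ())) _ _ _ _ _
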